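{- Let $G=D_n=\langle r,s\mid r^n=s^2=e,\ srs=r^{ -1}\rangle$ be the dihedral group of order $2n$, and suppose $n$ is even. If $H\leq G$ is a subgroup isomorphic to a dihedral group, of index $2$ in $G$, and of order divisible by $4$, then the restriction map $\operatorname{Res}:H^3(G,\mathbb{Z})\to H^3(H,\mathbb{Z})$ is injective.
   Context: Cohomology is group cohomology with coefficients in $\mathbb{Z}$ with trivial action. -}

module Defs where

open import Data.Nat using (ℕ; zero; suc; _∸_; NonZero; _%_)
import Data.Nat as ℕ
open import Data.Nat.DivMod using (m%n<n)
open import Data.Fin using (Fin; toℕ; fromℕ<)
open import Data.Bool using (Bool; true; false; T; _xor_)
open import Data.Integer using (ℤ; _+_; _-_; 0ℤ)
open import Data.List using (List; []; _∷_; length; filterᵇ; concatMap; allFin)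
open import Data.Product using (Σ; ∃; _×_; _,_; proj₁; proj₂)
open import Relation.Binary.PropositionalEquality using (_≡_)
open import Function.Definitions using (Bijective)

-- Group cohomology with trivial ℤ coefficients in degree 3, via the
-- standard (inhomogeneous bar) cochain complex of a group with
-- carrier A and multiplication _·_.

module Cohomology {A : Set} (_·_ : A → A → A) where

  C² : Set
  C² = A → A → ℤ

  C³ : Set
  C³ = A → A → A → ℤ

  δ² : C² → C³
  δ² φ g₁ g₂ g₃ = φ g₂ g₃ - φ (g₁ · g₂) g₃ + φ g₁ (g₂ · g₃) - φ g₁ g₂

  IsCocycle³ : C³ → Set
  IsCocycle³ f = ∀ g₁ g₂ g₃ g₄ →
    f g₂ g₃ g₄ - f (g₁ · g₂) g₃ g₄ + f g₁ (g₂ · g₃) g₄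
      - f g₁ g₂ (g₃ · g₄) + f g₁ g₂ g₃ ≡ 0ℤ

  IsCoboundary³ : C³ → Set
  IsCoboundary³ f = ∃ λ (φ : C²) → ∀ g₁ g₂ g₃ → f g₁ g₂ g₃ ≡ δ² φ g₁ g₂ g₃

-- The dihedral group D_n of order 2n: the element (i , b) stands for
-- r^i s^b  (b = true means one factor s).  Using s r^j = r^{-j} s:
-- r^i s^b · r^j s^c = r^{i + (-1)^b j} s^{b xor c}.

Dih : ℕ → Set
Dih n = Fin n × Bool

module _ {n : ℕ} {{_ : NonZero n}} where

  modn : ℕ → Fin n
  modn k = fromℕ< (m%n<n k n)

  dmul : Dih n → Dih n → Dih n
  dmul (i , false) (j , c) = modn (toℕ i ℕ.+ toℕ j) , c
  dmul (i , true)  (j , c) = modn (toℕ i ℕ.+ (n ∸ toℕ j)) , (true xor c)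

  dunit : Dih n
  dunit = modn 0 , false

  dinv : Dih n → Dih n
  dinv (i , false) = modn (n ∸ toℕ i) , false
  dinv (i , true)  = i , true

  allElems : List (Dih n)
  allElems = concatMap (λ i → (i , false) ∷ (i , true) ∷ []) (allFin n)

module _ {n : ℕ} {{_ : NonZero n}} where

  record Subgroup : Set where
    field
      mem   : Dih n → Bool
      mem-e : T (mem dunit)
      mem-· : ∀ {x y} → T (mem x) → T (mem y) → T (mem (dmul x y))
      mem-⁻ : ∀ {x} → T (mem x) → T (mem (dinv x))

  module _ (H : Subgroup) where
    open Subgroup H

    Carrier : Set
    Carrier = Σ (Dih n) (λ g → T (mem g))

    hmul : Carrier → Carrier → Carrier
    hmul (x , px) (y , py) = dmul x y , mem-· px py

    order : ℕ
    order = length (filterᵇ mem allElems)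

    -- [G : H] = |G| / |H| = 2  ⇔  |H| = n
    HasIndex2 : Set
    HasIndex2 = order ≡ n

    IsDihedral : Set
    IsDihedral = Σ ℕ λ m → Σ (NonZero m) λ nz →
      Σ (Dih m → Carrier) λ φ →
        Bijective _≡_ _≡_ φ ×
        (∀ x y → φ (dmul {m} {{nz}} x y) ≡ hmul (φ x) (φ y))

    -- Res : H³(D_n,ℤ) → H³(H,ℤ) is injective: a 3-cocycle on D_n whose
    -- restriction to H is a coboundary is itself a coboundary.
    ResInjective³ : Set
    ResInjective³ = ∀ (f : Cohomology.C³ dmul) →
      Cohomology.IsCocycle³ dmul f →
      Cohomology.IsCoboundary³ hmul
        (λ h₁ h₂ h₃ → f (proj₁ h₁) (proj₁ h₂) (proj₁ h₃)) →
      Cohomology.IsCoboundary³ dmul f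

{-# OPTIONS --safe #-}
module Submission where

-- Let G = Dₙ, n = 2m, and let f be a 3-cocycle whose restriction to H is a coboundary.
-- Summing f over its last argument gives a 2-cochain F with δF = −|G|·f, so F is a
-- 2-cocycle modulo |G|; if F ≡ c + δγ modulo |G| for an integral cocycle c, then
-- F = c + δγ + |G|·θ and f = δ(−θ).  Modifying F by coboundaries modulo |G| brings it
-- to a normal form determined by three integers k, B and A, which is the integral
-- cocycle k·Δ + B·carry as soon as A ≡ m·k.  That congruence follows from
-- F(rᵐ, t) ≡ F(t, rᵐ) for a reflection t ∈ H.  Since 4 divides |H| = 2m, H ≅ Dₘ contains
-- a Klein four-group, whose image in Dₙ forces rᵐ ∈ H and some reflection t ∈ H.  On the
-- Klein group {1, rᵐ, t, rᵐt} ⊆ H, where f = δφ, the cochain F + |G|·φ is an integral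
-- 2-cocycle of an abelian group, hence symmetric, which gives the congruence.

open import Defs
open import Algebra.Bundles using (AbelianGroup; Group)
import Algebra.Properties.Group as GroupProperties
open import Algebra.Structures using (IsGroup)
open import Data.Bool using (Bool; true; false; T; _xor_)
import Data.Bool.Properties as Bool
open import Data.Fin as Fin using (Fin; toℕ; splitAt; join)
import Data.Fin.Properties as Fin
open import Data.Fin.Permutation using (Permutation)
open import Data.Integer as ℤ using (ℤ; +_; -[1+_]; _+_; _-_; -_; _*_; 0ℤ; 1ℤ)
import Data.Integer.Properties as ℤ
open import Algebra.Properties.CommutativeMonoid.Sum ℤ.+-0-commutativeMonoid
  using (sum; sum-cong-≗; ∑-distrib-+; sum-permute)
open import Data.Integer.Tactic.RingSolver using (solve; solve-∀)
open import Data.List using (List; []; _∷_; length; lookup; filterᵇ; concatMap)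
open import Data.List.Membership.Propositional using (_∈_)
open import Data.List.Membership.Propositional.Properties
  using (∈-filter⁺; ∈-filter⁻; ∈-lookup; ∈-allFin; ∈-map⁺; ∈-concat⁺′)
open import Data.List.Relation.Unary.All as All using (All)
import Data.List.Relation.Unary.AllPairs as AllPairs
open import Data.List.Relation.Unary.Any as Any using (here; there)
open import Data.List.Relation.Unary.Any.Properties using (lookup-index)
open import Data.List.Relation.Unary.Unique.Propositional using (Unique)
import Data.List.Relation.Unary.Unique.Propositional.Properties as Unique
open import Data.Nat as ℕ using (ℕ; NonZero; zero; suc; _%_; _∸_)
import Data.Nat.Properties as ℕ
open import Data.Nat.DivMod using (m≡m%n+[m/n]*n; m%n<n; m<n⇒m%n≡m; [m+kn]%n≡m%n)
open import Data.Nat.Divisibility using (_∣_; divides)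
import Data.Nat.Tactic.RingSolver as ℕ-Ring
open import Data.Product using (Σ; ∃; _×_; _,_; proj₁; proj₂)
open import Data.Sum using (_⊎_; inj₁; inj₂; [_,_]′)
open import Function using (_∘_; _∘′_)
open import Function.Bundles using (_↔_; mk↔ₛ′; mk⤖; Inverse; Injection)
open import Function.Construct.Composition using (_↔-∘_)
open import Function.Definitions using (Bijective; Injective)
open import Function.Properties.Bijection using (⤖⇒↔)
open import Function.Properties.Inverse using (↔-sym; ↔⇒↣)
open import Level using (0ℓ)
open import Relation.Binary.Bundles using (Setoid)
import Relation.Binary.Reasoning.Setoid
open import Relation.Binary.PropositionalEquality
open import Relation.Nullary using (¬_; yes; no; contradiction)
open import Relation.Nullary.Decidable using (T?)

open GroupProperties (AbelianGroup.group ℤ.+-0-abelianGroup) using (inverseˡ-unique)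


module Congruence (M : ℤ) where

  infix 4 _≈_
  infixr 4 _,_
  record _≈_ (x y : ℤ) : Set where
    constructor _,_
    field
      quotient : ℤ
      equality : x ≡ y + quotient * M

  ≡⇒≈ : ∀ {x y} → x ≡ y → x ≈ y
  ≡⇒≈ {x} refl = 0ℤ , solve (x ∷ M ∷ [])

  ≈-sym : ∀ {x y} → x ≈ y → y ≈ x
  ≈-sym (q , eq) = - q , swap q eq
    where
    swap : ∀ {x y} q → x ≡ y + q * M → y ≡ x + - q * M
    swap {y = y} q refl = solve (y ∷ q ∷ M ∷ [])

  ≈-trans : ∀ {x y z} → x ≈ y → y ≈ z → x ≈ z
  ≈-trans {z = z} (q , refl) (q′ , refl) = q′ + q , solve (z ∷ q′ ∷ q ∷ M ∷ [])

  ≈-setoid : Setoid _ _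
  ≈-setoid = record
    { Carrier = ℤ
    ; _≈_ = _≈_
    ; isEquivalence = record { refl = ≡⇒≈ refl ; sym = ≈-sym ; trans = ≈-trans }
    }

  module ≈-Reasoning = Relation.Binary.Reasoning.Setoid ≈-setoid

  +-cong : ∀ {x y u v} → x ≈ y → u ≈ v → x + u ≈ y + v
  +-cong {y = y} {v = v} (q , refl) (q′ , refl) = q + q′ , solve (y ∷ v ∷ q ∷ q′ ∷ M ∷ [])

  +-congˡ : ∀ x {u v} → u ≈ v → x + u ≈ x + v
  +-congˡ x = +-cong (≡⇒≈ (refl {x = x}))

  +-congʳ : ∀ u {x y} → x ≈ y → x + u ≈ y + u
  +-congʳ u p = +-cong p (≡⇒≈ (refl {x = u}))

  neg-cong : ∀ {x y} → x ≈ y → - x ≈ - y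
  neg-cong {y = y} (q , refl) = - q , solve (y ∷ q ∷ M ∷ [])

  -‿congˡ : ∀ x {u v} → u ≈ v → x - u ≈ x - v
  -‿congˡ x p = +-congˡ x (neg-cong p)

  -‿cong : ∀ {x y u v} → x ≈ y → u ≈ v → x - u ≈ y - v
  -‿cong p q = +-cong p (neg-cong q)

  ≡-modulo-multiples : ∀ {a b} p q → a + M * p ≡ b + M * q → a ≈ b
  ≡-modulo-multiples {a} {b} p q eq = q - p , (begin
    a                          ≡⟨ shift a p ⟩
    a + M * p - M * p          ≡⟨ cong (λ x → x - M * p) eq ⟩
    b + M * q - M * p          ≡⟨ collect b p q ⟩
    b + (q - p) * M            ∎)
    where
    open ≡-Reasoning
    shift : ∀ a p → a ≡ a + M * p - M * p
    shift a p = solve (a ∷ M ∷ p ∷ [])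
    collect : ∀ b p q → b + M * q - M * p ≡ b + (q - p) * M
    collect b p q = solve (b ∷ M ∷ q ∷ p ∷ [])

  isolate₂ : ∀ {a b c d} → a - b + c - d ≈ 0ℤ → b ≈ a + c - d
  isolate₂ {a} {b} {c} {d} p = begin
    b                                ≡⟨ regroup a b c d ⟩
    a + c - d - (a - b + c - d)      ≈⟨ -‿congˡ (a + c - d) p ⟩
    a + c - d - 0ℤ                   ≡⟨ ℤ.+-identityʳ (a + c - d) ⟩
    a + c - d                        ∎
    where
    open ≈-Reasoning
    regroup : ∀ a b c d → b ≡ a + c - d - (a - b + c - d)
    regroup = solve-∀

  isolate₃ : ∀ {a b c d} → a - b + c - d ≈ 0ℤ → c ≈ b + d - a
  isolate₃ {a} {b} {c} {d} p = begin
    c                                ≡⟨ regroup a b c d ⟩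
    b + d - a + (a - b + c - d)      ≈⟨ +-congˡ (b + d - a) p ⟩
    b + d - a + 0ℤ                   ≡⟨ ℤ.+-identityʳ (b + d - a) ⟩
    b + d - a                        ∎
    where
    open ≈-Reasoning
    regroup : ∀ a b c d → c ≡ b + d - a + (a - b + c - d)
    regroup = solve-∀

  difference≈0 : ∀ {a b} → a - b ≈ 0ℤ → a ≈ b
  difference≈0 {a} {b} p = ≈-trans (≡⇒≈ (regroup a b)) (≈-trans (+-congʳ b p) (≡⇒≈ (ℤ.+-identityˡ b)))
    where
    regroup : ∀ a b → a ≡ a - b + b
    regroup = solve-∀

  modulus≈0 : M ≈ 0ℤ
  modulus≈0 = 1ℤ , solve (M ∷ [])

  multiple≈0 : ∀ q → q * M ≈ 0ℤ
  multiple≈0 q = q , solve (q ∷ M ∷ [])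


pos-∸ : ∀ {m n} → n ℕ.≤ m → + (m ∸ n) ≡ + m - + n
pos-∸ {m} {n} n≤m = trans (sym (ℤ.⊖-≥ n≤m)) (sym (ℤ.m-n≡m⊖n m n))

negateIf : Bool → ℤ → ℤ
negateIf false z = z
negateIf true  z = - z

negateIf-xor : ∀ b c z → negateIf (b xor c) z ≡ negateIf b (negateIf c z)
negateIf-xor false c z = refl
negateIf-xor true false z = refl
negateIf-xor true true z = sym (ℤ.neg-involutive z)

negateIf-+ : ∀ b x y → negateIf b (x + y) ≡ negateIf b x + negateIf b y
negateIf-+ false x y = refl
negateIf-+ true x y = ℤ.neg-distrib-+ x y

module DihedralGroup {n : ℕ} {{_ : NonZero n}} where

  open Congruence (+ n)

  exponent : Dih n → ℤ
  exponent (i , _) = + toℕ i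

  negateIf-cong : ∀ b {x y} → x ≈ y → negateIf b x ≈ negateIf b y
  negateIf-cong false p = p
  negateIf-cong true p = neg-cong p

  toℤ-modn : ∀ k → + toℕ (modn {n} k) ≈ + k
  toℤ-modn k = ≈-sym (+ (k ℕ./ n) , (begin
    + k                              ≡⟨ cong +_ (m≡m%n+[m/n]*n k n) ⟩
    + (k % n ℕ.+ k ℕ./ n ℕ.* n)      ≡⟨ ℤ.pos-+ (k % n) _ ⟩
    + (k % n) + + (k ℕ./ n ℕ.* n)    ≡⟨ cong (_+_ (+ (k % n))) (ℤ.pos-* (k ℕ./ n) n) ⟩
    + (k % n) + + (k ℕ./ n) * + n    ≡⟨ cong (λ m → + m + + (k ℕ./ n) * + n) (sym (Fin.toℕ-fromℕ< (m%n<n k n))) ⟩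
    + toℕ (modn k) + + (k ℕ./ n) * + n ∎))
    where open ≡-Reasoning

  private
    fin-injective⁺ : ∀ {i j : Fin n} q → + toℕ i ≡ + toℕ j + + q * + n → i ≡ j
    fin-injective⁺ {i} {j} q eq = Fin.toℕ-injective (begin
      toℕ i                      ≡⟨ m<n⇒m%n≡m (Fin.toℕ<n i) ⟨
      toℕ i % n                  ≡⟨ cong (_% n) (ℤ.+-injective eq′) ⟩
      (toℕ j ℕ.+ q ℕ.* n) % n    ≡⟨ [m+kn]%n≡m%n (toℕ j) q n ⟩
      toℕ j % n                  ≡⟨ m<n⇒m%n≡m (Fin.toℕ<n j) ⟩
      toℕ j                      ∎)
      where
      open ≡-Reasoning
      eq′ : + toℕ i ≡ + (toℕ j ℕ.+ q ℕ.* n)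
      eq′ = trans eq (sym (trans (ℤ.pos-+ (toℕ j) _) (cong (_+_ (+ toℕ j)) (ℤ.pos-* q n))))

  ≡-byExponent : ∀ {x y : Dih n} → exponent x ≈ exponent y → proj₂ x ≡ proj₂ y → x ≡ y
  ≡-byExponent {_ , b} (+ q , eq) refl = cong (_, b) (fin-injective⁺ q eq)
  ≡-byExponent {_ , b} (-[1+ q ] , eq) refl =
    cong (_, b) (sym (fin-injective⁺ (ℕ.suc q) (_≈_.equality (≈-sym (-[1+ q ] , eq)))))

  exponent-complement : ∀ (j : Fin n) → + (n ∸ toℕ j) ≈ - + toℕ j
  exponent-complement j = begin
    + (n ∸ toℕ j)     ≡⟨ pos-∸ (ℕ.<⇒≤ (Fin.toℕ<n j)) ⟩
    + n - + toℕ j     ≈⟨ +-congʳ (- + toℕ j) modulus≈0 ⟩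
    0ℤ - + toℕ j      ≡⟨ ℤ.+-identityˡ _ ⟩
    - + toℕ j         ∎
    where open ≈-Reasoning

  exponent-dmul : ∀ (x y : Dih n) → exponent (dmul x y) ≈ exponent x + negateIf (proj₂ x) (exponent y)
  exponent-dmul (i , false) (j , c) = begin
    exponent (dmul (i , false) (j , c))  ≈⟨ toℤ-modn (toℕ i ℕ.+ toℕ j) ⟩
    + (toℕ i ℕ.+ toℕ j)                  ≡⟨ ℤ.pos-+ (toℕ i) (toℕ j) ⟩
    + toℕ i + + toℕ j                     ∎
    where open ≈-Reasoning
  exponent-dmul (i , true) (j , c) = begin
    exponent (dmul (i , true) (j , c))   ≈⟨ toℤ-modn (toℕ i ℕ.+ (n ∸ toℕ j)) ⟩
    + (toℕ i ℕ.+ (n ∸ toℕ j))            ≡⟨ ℤ.pos-+ (toℕ i) (n ∸ toℕ j) ⟩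
    + toℕ i + + (n ∸ toℕ j)              ≈⟨ +-congˡ (+ toℕ i) (exponent-complement j) ⟩
    + toℕ i - + toℕ j                     ∎
    where open ≈-Reasoning

  flag-dmul : ∀ (x y : Dih n) → proj₂ (dmul x y) ≡ proj₂ x xor proj₂ y
  flag-dmul (_ , false) _ = refl
  flag-dmul (_ , true)  _ = refl

  dmul-assoc : ∀ (x y z : Dih n) → dmul (dmul x y) z ≡ dmul x (dmul y z)
  dmul-assoc x@(_ , b) y@(_ , c) z = ≡-byExponent exponents flags
    where
    exponents : exponent (dmul (dmul x y) z) ≈ exponent (dmul x (dmul y z))
    exponents = begin
      exponent (dmul (dmul x y) z)
        ≈⟨ exponent-dmul (dmul x y) z ⟩
      exponent (dmul x y) + negateIf (proj₂ (dmul x y)) (exponent z)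
        ≡⟨ cong (λ f → exponent (dmul x y) + negateIf f (exponent z)) (flag-dmul x y) ⟩
      exponent (dmul x y) + negateIf (b xor c) (exponent z)
        ≈⟨ +-cong (exponent-dmul x y) (≡⇒≈ (negateIf-xor b c (exponent z))) ⟩
      exponent x + negateIf b (exponent y) + negateIf b (negateIf c (exponent z))
        ≡⟨ ℤ.+-assoc (exponent x) (negateIf b (exponent y)) (negateIf b (negateIf c (exponent z))) ⟩
      exponent x + (negateIf b (exponent y) + negateIf b (negateIf c (exponent z)))
        ≡⟨ cong (_+_ (exponent x)) (negateIf-+ b (exponent y) _) ⟨
      exponent x + negateIf b (exponent y + negateIf c (exponent z))
        ≈⟨ +-congˡ (exponent x) (negateIf-cong b (exponent-dmul y z)) ⟨
      exponent x + negateIf b (exponent (dmul y z))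
        ≈⟨ exponent-dmul x (dmul y z) ⟨
      exponent (dmul x (dmul y z)) ∎
      where open ≈-Reasoning
    flags : proj₂ (dmul (dmul x y) z) ≡ proj₂ (dmul x (dmul y z))
    flags = begin
      proj₂ (dmul (dmul x y) z)   ≡⟨ flag-dmul (dmul x y) z ⟩
      proj₂ (dmul x y) xor _      ≡⟨ cong (_xor proj₂ z) (flag-dmul x y) ⟩
      (b xor c) xor proj₂ z       ≡⟨ Bool.xor-assoc b c (proj₂ z) ⟩
      b xor (c xor proj₂ z)       ≡⟨ cong (b xor_) (flag-dmul y z) ⟨
      b xor proj₂ (dmul y z)      ≡⟨ flag-dmul x (dmul y z) ⟨
      proj₂ (dmul x (dmul y z))   ∎
      where open ≡-Reasoning

  exponent-dunit : exponent (dunit {n}) ≈ 0ℤ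
  exponent-dunit = toℤ-modn 0

  ≡-dunit : ∀ {x : Dih n} → exponent x ≈ 0ℤ → proj₂ x ≡ false → x ≡ dunit
  ≡-dunit p = ≡-byExponent (≈-trans p (≈-sym exponent-dunit))

  dmul-identityˡ : ∀ (x : Dih n) → dmul dunit x ≡ x
  dmul-identityˡ x = ≡-byExponent (begin
    exponent (dmul dunit x)       ≈⟨ exponent-dmul dunit x ⟩
    exponent dunit + exponent x   ≈⟨ +-congʳ (exponent x) exponent-dunit ⟩
    0ℤ + exponent x               ≡⟨ ℤ.+-identityˡ (exponent x) ⟩
    exponent x                    ∎) refl
    where open ≈-Reasoning

  dmul-identityʳ : ∀ (x : Dih n) → dmul x dunit ≡ x
  dmul-identityʳ x@(_ , b) = ≡-byExponent (begin
    exponent (dmul x dunit)                  ≈⟨ exponent-dmul x dunit ⟩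
    exponent x + negateIf b (exponent dunit) ≈⟨ +-congˡ (exponent x) (negateIf-cong b exponent-dunit) ⟩
    exponent x + negateIf b 0ℤ               ≡⟨ cong (_+_ (exponent x)) (negateIf-0 b) ⟩
    exponent x + 0ℤ                          ≡⟨ ℤ.+-identityʳ (exponent x) ⟩
    exponent x                               ∎) (trans (flag-dmul x dunit) (Bool.xor-identityʳ b))
    where
    open ≈-Reasoning
    negateIf-0 : ∀ b → negateIf b 0ℤ ≡ 0ℤ
    negateIf-0 false = refl
    negateIf-0 true  = refl

  exponent-rotation⁻¹ : ∀ (i : Fin n) → exponent (dinv (i , false)) ≈ - + toℕ i
  exponent-rotation⁻¹ i = ≈-trans (toℤ-modn (n ∸ toℕ i)) (exponent-complement i)

  dinv-inverseˡ : ∀ (x : Dih n) → dmul (dinv x) x ≡ dunit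
  dinv-inverseˡ x@(i , false) = ≡-dunit (begin
    exponent (dmul (dinv x) x)            ≈⟨ exponent-dmul (dinv x) x ⟩
    exponent (dinv x) + exponent x        ≈⟨ +-congʳ (exponent x) (exponent-rotation⁻¹ i) ⟩
    - exponent x + exponent x             ≡⟨ ℤ.+-inverseˡ (exponent x) ⟩
    0ℤ                                    ∎) refl
    where open ≈-Reasoning
  dinv-inverseˡ x@(i , true) =
    ≡-dunit (≈-trans (exponent-dmul x x) (≡⇒≈ (ℤ.+-inverseʳ (exponent x)))) refl

  dinv-inverseʳ : ∀ (x : Dih n) → dmul x (dinv x) ≡ dunit
  dinv-inverseʳ x@(i , false) = ≡-dunit (begin
    exponent (dmul x (dinv x))            ≈⟨ exponent-dmul x (dinv x) ⟩
    exponent x + exponent (dinv x)        ≈⟨ +-congˡ (exponent x) (exponent-rotation⁻¹ i) ⟩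
    exponent x - exponent x               ≡⟨ ℤ.+-inverseʳ (exponent x) ⟩
    0ℤ                                    ∎) refl
    where open ≈-Reasoning
  dinv-inverseʳ x@(i , true) =
    ≡-dunit (≈-trans (exponent-dmul x x) (≡⇒≈ (ℤ.+-inverseʳ (exponent x)))) refl

  isGroup : IsGroup _≡_ dmul dunit dinv
  isGroup = record
    { isMonoid = record
      { isSemigroup = record
        { isMagma = record { isEquivalence = isEquivalence ; ∙-cong = cong₂ dmul }
        ; assoc = dmul-assoc
        }
      ; identity = dmul-identityˡ , dmul-identityʳ
      }
    ; inverse = dinv-inverseˡ , dinv-inverseʳ
    ; ⁻¹-cong = cong dinv
    }

dihedralGroup : (n : ℕ) → {{NonZero n}} → Group 0ℓ 0ℓ
dihedralGroup n = record { isGroup = DihedralGroup.isGroup {n} }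

module DihedralGroupProperties {n : ℕ} {{_ : NonZero n}} =
  GroupProperties (dihedralGroup n)

module _ {A : Set} (_·_ : A → A → A) where

  open Cohomology _·_

  δ²-+ : ∀ (a b : C²) x y z → δ² (λ u v → a u v + b u v) x y z ≡ δ² a x y z + δ² b x y z
  δ²-+ a b x y z = expand (a y z) (a (x · y) z) (a x (y · z)) (a x y)
                          (b y z) (b (x · y) z) (b x (y · z)) (b x y)
    where
    expand : ∀ a₁ a₂ a₃ a₄ b₁ b₂ b₃ b₄ →
      a₁ + b₁ - (a₂ + b₂) + (a₃ + b₃) - (a₄ + b₄) ≡ a₁ - a₂ + a₃ - a₄ + (b₁ - b₂ + b₃ - b₄)
    expand = solve-∀

  δ²-cong : ∀ {a b : C²} → (∀ x y → a x y ≡ b x y) → ∀ x y z → δ² a x y z ≡ δ² b x y z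
  δ²-cong a≡b x y z = cong₂ _-_ (cong₂ _+_ (cong₂ _-_ (a≡b y z) (a≡b (x · y) z)) (a≡b x (y · z))) (a≡b x y)

  δ²-scale : ∀ (c : C²) k x y z → δ² (λ u v → k * c u v) x y z ≡ k * δ² c x y z
  δ²-scale c k x y z = expand (c y z) (c (x · y) z) (c x (y · z)) (c x y) k
    where
    expand : ∀ a b c d k → k * a - k * b + k * c - k * d ≡ k * (a - b + c - d)
    expand = solve-∀

  δ²-neg : ∀ (c : C²) x y z → δ² (λ u v → - c u v) x y z ≡ - δ² c x y z
  δ²-neg c x y z = expand (c y z) (c (x · y) z) (c x (y · z)) (c x y)
    where
    expand : ∀ a b c d → - a - - b + - c - - d ≡ - (a - b + c - d)
    expand = solve-∀

  δ¹ : (A → ℤ) → C²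
  δ¹ β x y = β y - β (x · y) + β x

  δ²∘δ¹ : (∀ x y z → (x · y) · z ≡ x · (y · z)) → ∀ β x y z → δ² (δ¹ β) x y z ≡ 0ℤ
  δ²∘δ¹ assoc β x y z = trans
    (cancel (β z) (β (y · z)) (β y) (β ((x · y) · z)) (β (x · (y · z))) (β (x · y)) (β x))
    (trans (cong (λ w → β w - β (x · (y · z))) (assoc x y z)) (ℤ.+-inverseʳ (β (x · (y · z)))))
    where
    cancel : ∀ a b c d d′ e f →
      (a - b + c) - (a - d + e) + (b - d′ + f) - (c - e + f) ≡ d - d′
    cancel = solve-∀

module _ {A B : Set} (_·_ : A → A → A) (_∙_ : B → B → B)
         (h : A → B) (hom : ∀ x y → h (x · y) ≡ h x ∙ h y) where

  δ²-pullback : ∀ (c : B → B → ℤ) x y z →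
    Cohomology.δ² _·_ (λ u v → c (h u) (h v)) x y z ≡ Cohomology.δ² _∙_ c (h x) (h y) (h z)
  δ²-pullback c x y z =
    cong₂ (λ u v → c (h y) (h z) - c u (h z) + c (h x) v - c (h x) (h y)) (hom x y) (hom y z)

record LeftInvariantSum {A : Set} (_·_ : A → A → A) : Set where
  field
    ∑           : (A → ℤ) → ℤ
    size        : ℤ
    ∑-cong      : ∀ {f g} → (∀ x → f x ≡ g x) → ∑ f ≡ ∑ g
    ∑-+         : ∀ f g → ∑ (λ x → f x + g x) ≡ ∑ f + ∑ g
    ∑-const     : ∀ c → ∑ (λ _ → c) ≡ size * c
    ∑-translate : ∀ y f → ∑ (λ x → f (y · x)) ≡ ∑ f

  ∑-zero : ∀ {f} → (∀ x → f x ≡ 0ℤ) → ∑ f ≡ 0ℤ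
  ∑-zero f≡0 = trans (∑-cong f≡0) (trans (∑-const 0ℤ) (ℤ.*-zeroʳ size))

  ∑-neg : ∀ f → ∑ (λ x → - f x) ≡ - ∑ f
  ∑-neg f = inverseˡ-unique (∑ (λ x → - f x)) (∑ f)
    (trans (sym (∑-+ (λ x → - f x) f)) (∑-zero (ℤ.+-inverseˡ ∘ f)))

  ∑-minus : ∀ f g → ∑ (λ x → f x - g x) ≡ ∑ f - ∑ g
  ∑-minus f g = trans (∑-+ f (λ x → - g x)) (cong (_+_ (∑ f)) (∑-neg g))

  ∑-alternating : ∀ a b c d → ∑ (λ x → a x - b x + c x - d x) ≡ ∑ a - ∑ b + ∑ c - ∑ d
  ∑-alternating a b c d = begin
    ∑ (λ x → a x - b x + c x - d x)   ≡⟨ ∑-minus (λ x → a x - b x + c x) d ⟩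
    ∑ (λ x → a x - b x + c x) - ∑ d   ≡⟨ cong (_- ∑ d) (∑-+ (λ x → a x - b x) c) ⟩
    ∑ (λ x → a x - b x) + ∑ c - ∑ d   ≡⟨ cong (λ s → s + ∑ c - ∑ d) (∑-minus a b) ⟩
    ∑ a - ∑ b + ∑ c - ∑ d             ∎
    where open ≡-Reasoning

module Averaging {A : Set} {_·_ : A → A → A} (S : LeftInvariantSum _·_) where

  open LeftInvariantSum S
  open Cohomology _·_

  IsCocycle² : C² → Set
  IsCocycle² c = ∀ x y z → δ² c x y z ≡ 0ℤ

  -- Summing the cocycle identity over its last variable; translation
  -- invariance turns the sum of c x (y · w) into the sum of c x w.
  averaging² : ∀ c → IsCocycle² c → ∀ x y →
    ∑ (c y) - ∑ (c (x · y)) + ∑ (c x) ≡ size * c x y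
  averaging² c cocycle x y = ℤ.i-j≡0⇒i≡j _ _ (begin
    ∑ (c y) - ∑ (c (x · y)) + ∑ (c x) - size * c x y
      ≡⟨ cong₂ (λ s t → ∑ (c y) - ∑ (c (x · y)) + s - t)
           (sym (∑-translate y (c x))) (sym (∑-const (c x y))) ⟩
    ∑ (c y) - ∑ (c (x · y)) + ∑ (λ w → c x (y · w)) - ∑ (λ _ → c x y)
      ≡⟨ ∑-alternating (c y) (c (x · y)) (λ w → c x (y · w)) (λ _ → c x y) ⟨
    ∑ (δ² c x y)
      ≡⟨ ∑-zero (cocycle x y) ⟩
    0ℤ ∎)
    where open ≡-Reasoning

  averaging³ : ∀ f → IsCocycle³ f → ∀ g₁ g₂ g₃ →
    δ² (λ a b → ∑ (f a b)) g₁ g₂ g₃ ≡ - (size * f g₁ g₂ g₃)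
  averaging³ f cocycle g₁ g₂ g₃ = inverseˡ-unique _ _ (begin
    F g₂ g₃ - F (g₁ · g₂) g₃ + F g₁ (g₂ · g₃) - F g₁ g₂ + size * f g₁ g₂ g₃
      ≡⟨ cong₂ (λ s t → F g₂ g₃ - F (g₁ · g₂) g₃ + F g₁ (g₂ · g₃) - s + t)
           (sym (∑-translate g₃ (f g₁ g₂))) (sym (∑-const (f g₁ g₂ g₃))) ⟩
    F g₂ g₃ - F (g₁ · g₂) g₃ + F g₁ (g₂ · g₃) - ∑ (λ g → f g₁ g₂ (g₃ · g)) + ∑ (λ _ → f g₁ g₂ g₃)
      ≡⟨ cong (_+ ∑ (λ _ → f g₁ g₂ g₃))
              (∑-alternating (f g₂ g₃) (f (g₁ · g₂) g₃) (f g₁ (g₂ · g₃)) (λ g → f g₁ g₂ (g₃ · g))) ⟨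
    ∑ (λ g → f g₂ g₃ g - f (g₁ · g₂) g₃ g + f g₁ (g₂ · g₃) g - f g₁ g₂ (g₃ · g)) + ∑ (λ _ → f g₁ g₂ g₃)
      ≡⟨ ∑-+ _ (λ _ → f g₁ g₂ g₃) ⟨
    ∑ (λ g → f g₂ g₃ g - f (g₁ · g₂) g₃ g + f g₁ (g₂ · g₃) g - f g₁ g₂ (g₃ · g) + f g₁ g₂ g₃)
      ≡⟨ ∑-zero (cocycle g₁ g₂ g₃) ⟩
    0ℤ ∎)
    where
    open ≡-Reasoning
    F : A → A → ℤ
    F a b = ∑ (f a b)

  averaging³-mod : ∀ f → IsCocycle³ f → ∀ g₁ g₂ g₃ →
    Congruence._≈_ size (δ² (λ a b → ∑ (f a b)) g₁ g₂ g₃) 0ℤ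
  averaging³-mod f cocycle g₁ g₂ g₃ = begin
    δ² (λ a b → ∑ (f a b)) g₁ g₂ g₃    ≡⟨ averaging³ f cocycle g₁ g₂ g₃ ⟩
    - (size * f g₁ g₂ g₃)              ≡⟨ ℤ.neg-distribʳ-* size (f g₁ g₂ g₃) ⟩
    size * - f g₁ g₂ g₃                ≡⟨ ℤ.*-comm size (- f g₁ g₂ g₃) ⟩
    - f g₁ g₂ g₃ * size                ≈⟨ multiple≈0 (- f g₁ g₂ g₃) ⟩
    0ℤ                                 ∎
    where
    open Congruence size
    open ≈-Reasoning

  cocycle²-comm : .{{ℤ.NonZero size}} → (∀ x y → x · y ≡ y · x) →
    ∀ c → IsCocycle² c → ∀ x y → c x y ≡ c y x
  cocycle²-comm comm c cocycle x y = ℤ.*-cancelˡ-≡ size (c x y) (c y x) (begin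
    size * c x y                          ≡⟨ averaging² c cocycle x y ⟨
    ∑ (c y) - ∑ (c (x · y)) + ∑ (c x)     ≡⟨ cong (λ z → ∑ (c y) - ∑ (c z) + ∑ (c x)) (comm x y) ⟩
    ∑ (c y) - ∑ (c (y · x)) + ∑ (c x)     ≡⟨ swap (∑ (c y)) (∑ (c (y · x))) (∑ (c x)) ⟩
    ∑ (c x) - ∑ (c (y · x)) + ∑ (c y)     ≡⟨ averaging² c cocycle y x ⟩
    size * c y x                          ∎)
    where
    open ≡-Reasoning
    swap : ∀ a b c → a - b + c ≡ c - b + a
    swap = solve-∀

module _ {A : Set} (_·_ : A → A → A) (M : ℤ) where

  open Cohomology _·_
  open Congruence M using (_≈_)

  record IntegralLift (u : C²) : Set where
    field
      cocycle     : C²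
      isCocycle   : ∀ x y z → δ² cocycle x y z ≡ 0ℤ
      γ           : A → ℤ
      lift        : ∀ x y → u x y ≈ cocycle x y + δ¹ _·_ γ x y

module _ {A : Set} {_·_ : A → A → A} (S : LeftInvariantSum _·_) where

  open LeftInvariantSum S
  open Cohomology _·_
  open Averaging S using (averaging³)

  coboundary-from-lift : .{{ℤ.NonZero size}} → (∀ x y z → (x · y) · z ≡ x · (y · z)) →
    ∀ f → IsCocycle³ f → IntegralLift _·_ size (λ a b → ∑ (f a b)) → IsCoboundary³ f
  coboundary-from-lift assoc f f-cocycle L = (λ x y → - θ x y) , f≡δ²φ
    where
    open IntegralLift L
    open Congruence size using (module _≈_)
    F c′ : C²
    F a b = ∑ (f a b)
    c′ x y = cocycle x y + δ¹ _·_ γ x y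
    θ : C²
    θ x y = _≈_.quotient (lift x y)
    f≡δ²φ : ∀ g₁ g₂ g₃ → f g₁ g₂ g₃ ≡ δ² (λ x y → - θ x y) g₁ g₂ g₃
    f≡δ²φ g₁ g₂ g₃ = ℤ.*-cancelˡ-≡ size _ _ (begin
      size * f g₁ g₂ g₃
        ≡⟨ ℤ.neg-involutive _ ⟨
      - - (size * f g₁ g₂ g₃)
        ≡⟨ cong -_ (averaging³ f f-cocycle g₁ g₂ g₃) ⟨
      - δ² F g₁ g₂ g₃
        ≡⟨ cong -_ (δ²-cong _·_ (λ x y → _≈_.equality (lift x y)) g₁ g₂ g₃) ⟩
      - δ² (λ x y → c′ x y + θ x y * size) g₁ g₂ g₃
        ≡⟨ cong -_ (δ²-+ _·_ c′ (λ x y → θ x y * size) g₁ g₂ g₃) ⟩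
      - (δ² c′ g₁ g₂ g₃ + δ² (λ x y → θ x y * size) g₁ g₂ g₃)
        ≡⟨ cong (λ a → - (a + δ² (λ x y → θ x y * size) g₁ g₂ g₃)) c′-cocycle ⟩
      - (0ℤ + δ² (λ x y → θ x y * size) g₁ g₂ g₃)
        ≡⟨ cong -_ (ℤ.+-identityˡ _) ⟩
      - δ² (λ x y → θ x y * size) g₁ g₂ g₃
        ≡⟨ cong -_ (δ²-cong _·_ (λ x y → ℤ.*-comm (θ x y) size) g₁ g₂ g₃) ⟩
      - δ² (λ x y → size * θ x y) g₁ g₂ g₃
        ≡⟨ cong -_ (δ²-scale _·_ θ size g₁ g₂ g₃) ⟩
      - (size * δ² θ g₁ g₂ g₃)
        ≡⟨ ℤ.neg-distribʳ-* size _ ⟩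
      size * - δ² θ g₁ g₂ g₃
        ≡⟨ cong (size *_) (δ²-neg _·_ θ g₁ g₂ g₃) ⟨
      size * δ² (λ x y → - θ x y) g₁ g₂ g₃ ∎)
      where
      open ≡-Reasoning
      c′-cocycle : δ² c′ g₁ g₂ g₃ ≡ 0ℤ
      c′-cocycle = begin
        δ² c′ g₁ g₂ g₃
          ≡⟨ δ²-+ _·_ cocycle (δ¹ _·_ γ) g₁ g₂ g₃ ⟩
        δ² cocycle g₁ g₂ g₃ + δ² (δ¹ _·_ γ) g₁ g₂ g₃
          ≡⟨ cong₂ _+_ (isCocycle g₁ g₂ g₃) (δ²∘δ¹ _·_ assoc γ g₁ g₂ g₃) ⟩
        0ℤ ∎

module _ {n : ℕ} where

  private
    tag : Fin n ⊎ Fin n → Dih n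
    tag = [ (_, false) , (_, true) ]′

    untag : Dih n → Fin n ⊎ Fin n
    untag (i , false) = inj₁ i
    untag (i , true)  = inj₂ i

  Dih↔Fin : Dih n ↔ Fin (n ℕ.+ n)
  Dih↔Fin = mk↔ₛ′ (join n n ∘ untag) (tag ∘ splitAt n) to-from from-to
    where
    to-from : ∀ k → join n n (untag (tag (splitAt n k))) ≡ k
    to-from k with splitAt n k in eq
    ... | inj₁ i = trans (cong (join n n) (sym eq)) (Fin.join-splitAt n n k)
    ... | inj₂ i = trans (cong (join n n) (sym eq)) (Fin.join-splitAt n n k)
    from-to : ∀ x → tag (splitAt n (join n n (untag x))) ≡ x
    from-to (i , false) = cong tag (Fin.splitAt-join n n (inj₁ i))
    from-to (i , true)  = cong tag (Fin.splitAt-join n n (inj₂ i))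

sum-const : ∀ {k} c → sum {k} (λ _ → c) ≡ + k * c
sum-const {ℕ.zero} c = sym (ℤ.*-zeroˡ c)
sum-const {ℕ.suc k} c = trans (cong (_+_ c) (sum-const {k} c)) (step (+ k) c)
  where
  step : ∀ k c → c + k * c ≡ (+ 1 + k) * c
  step = solve-∀

dihedralSum : ∀ {n} {{_ : NonZero n}} → LeftInvariantSum (dmul {n})
dihedralSum {n} = record
  { ∑           = λ f → sum (f ∘ from)
  ; size        = + (n ℕ.+ n)
  ; ∑-cong      = λ f≗g → sum-cong-≗ (f≗g ∘ from)
  ; ∑-+         = λ f g → ∑-distrib-+ (f ∘ from) (g ∘ from)
  ; ∑-const     = sum-const {n ℕ.+ n}
  ; ∑-translate = translate
  }
  where
  open Inverse (Dih↔Fin {n})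
  open DihedralGroupProperties {n} using (\\-leftDividesˡ; \\-leftDividesʳ)
  translate : ∀ y f → sum (λ k → f (dmul y (from k))) ≡ sum (f ∘ from)
  translate y f = sym (trans (sum-permute (f ∘ from) π)
                             (sum-cong-≗ λ k → cong f (strictlyInverseʳ (dmul y (from k)))))
    where
    y· : Dih n ↔ Dih n
    y· = mk↔ₛ′ (dmul y) (dmul (dinv y)) (\\-leftDividesˡ y) (\\-leftDividesʳ y)
    π : Permutation (n ℕ.+ n) (n ℕ.+ n)
    π = Dih↔Fin ↔-∘ (y· ↔-∘ ↔-sym Dih↔Fin)

module _ {n : ℕ} where

  private
    pair : Fin n → List (Dih n)
    pair i = (i , false) ∷ (i , true) ∷ []

    fresh : ∀ {i is b} → All (λ j → ¬ i ≡ j) is → All (λ y → ¬ (i , b) ≡ y) (concatMap pair is)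
    fresh All.[] = All.[]
    fresh (i≢j All.∷ i∉is) = (i≢j ∘ cong proj₁) All.∷ (i≢j ∘ cong proj₁) All.∷ fresh i∉is

    concatMap-pair-unique : ∀ {is} → Unique is → Unique (concatMap pair is)
    concatMap-pair-unique AllPairs.[] = AllPairs.[]
    concatMap-pair-unique (i∉is AllPairs.∷ u) =
      ((λ ()) All.∷ fresh i∉is) AllPairs.∷ fresh i∉is AllPairs.∷ concatMap-pair-unique u

  allElems-unique : {{_ : NonZero n}} → Unique (allElems {n})
  allElems-unique = concatMap-pair-unique (Unique.allFin⁺ n)

  allElems-complete : {{_ : NonZero n}} → ∀ (x : Dih n) → x ∈ allElems
  allElems-complete (i , b) = ∈-concat⁺′ (∈-pair b) (∈-map⁺ pair (∈-allFin i))
    where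
    ∈-pair : ∀ b → (i , b) ∈ pair i
    ∈-pair false = here refl
    ∈-pair true  = there (here refl)

module _ {A : Set} where

  lookup-injective : ∀ {xs : List A} → Unique xs → ∀ {i j} → lookup xs i ≡ lookup xs j → i ≡ j
  lookup-injective (_ AllPairs.∷ _)     {Fin.zero}  {Fin.zero}  _  = refl
  lookup-injective (x∉xs AllPairs.∷ _)  {Fin.zero}  {Fin.suc j} eq = contradiction eq (All.lookup x∉xs (∈-lookup j))
  lookup-injective (x∉xs AllPairs.∷ _)  {Fin.suc i} {Fin.zero}  eq = contradiction (sym eq) (All.lookup x∉xs (∈-lookup i))
  lookup-injective (_ AllPairs.∷ u)     {Fin.suc i} {Fin.suc j} eq = cong Fin.suc (lookup-injective u eq)

  subset-≡ : ∀ {p : A → Bool} {x y} {px : T (p x)} {py : T (p y)} → x ≡ y → (x , px) ≡ (y , py)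
  subset-≡ refl = cong (_ ,_) (Bool.T-irrelevant _ _)

  filterᵇ↔ : (p : A → Bool) {xs : List A} → Unique xs → (∀ x → x ∈ xs) →
    Fin (length (filterᵇ p xs)) ↔ Σ A (T ∘ p)
  filterᵇ↔ p {xs} unique complete = mk↔ₛ′ to from to-from from-to
    where
    ys : List A
    ys = filterᵇ p xs
    to : Fin (length ys) → Σ A (T ∘ p)
    to i = lookup ys i , proj₂ (∈-filter⁻ (T? ∘ p) {xs = xs} (∈-lookup i))
    position : ∀ {x} → T (p x) → x ∈ ys
    position {x} px = ∈-filter⁺ (T? ∘ p) (complete x) px
    from : Σ A (T ∘ p) → Fin (length ys)
    from (_ , px) = Any.index (position px)
    to-from : ∀ y → to (from y) ≡ y
    to-from (x , px) = subset-≡ (sym (lookup-index (position px)))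
    from-to : ∀ i → from (to i) ≡ i
    from-to i = lookup-injective (Unique.filter⁺ (T? ∘ p) unique) (sym (lookup-index (position (proj₂ (to i)))))

module _ {n : ℕ} {{_ : NonZero n}} (H : Subgroup {n}) where

  Fin-order↔Carrier : Fin (order H) ↔ Carrier H
  Fin-order↔Carrier = filterᵇ↔ (Subgroup.mem H) allElems-unique allElems-complete

  order-bijection : ∀ {m} (φ : Dih m → Carrier H) → Bijective _≡_ _≡_ φ → order H ≡ m ℕ.+ m
  order-bijection {m} φ bij = Fin.cantor-schröder-bernstein
    (Injection.injective (↔⇒↣ e)) (Injection.injective (↔⇒↣ (↔-sym e)))
    where
    e : Fin (order H) ↔ Fin (m ℕ.+ m)
    e = Dih↔Fin ↔-∘ (↔-sym (⤖⇒↔ (mk⤖ bij)) ↔-∘ Fin-order↔Carrier)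

Klein : Set
Klein = Bool × Bool

kmul : Klein → Klein → Klein
kmul (a , b) (c , d) = a xor c , b xor d

kleinSum : LeftInvariantSum kmul
kleinSum = record
  { ∑           = ∑
  ; size        = + 4
  ; ∑-cong      = λ f≗g → cong₂ _+_ (cong₂ _+_ (cong₂ _+_ (f≗g _) (f≗g _)) (f≗g _)) (f≗g _)
  ; ∑-+         = λ f g → distrib (f ff) (f ft) (f tf) (f tt) (g ff) (g ft) (g tf) (g tt)
  ; ∑-const     = const
  ; ∑-translate = translate
  }
  where
  ff ft tf tt : Klein
  ff = false , false
  ft = false , true
  tf = true , false
  tt = true , true
  ∑ : (Klein → ℤ) → ℤ
  ∑ f = f ff + f ft + f tf + f tt
  distrib : ∀ a b c d a′ b′ c′ d′ →
    a + a′ + (b + b′) + (c + c′) + (d + d′) ≡ a + b + c + d + (a′ + b′ + c′ + d′)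
  distrib = solve-∀
  const : ∀ c → c + c + c + c ≡ + 4 * c
  const = solve-∀
  translate : ∀ y f → ∑ (λ x → f (kmul y x)) ≡ ∑ f
  translate (false , false) f = refl
  translate (false , true) f = swaps (f ff) (f ft) (f tf) (f tt)
    where
    swaps : ∀ a b c d → b + a + d + c ≡ a + b + c + d
    swaps = solve-∀
  translate (true , false) f = swaps (f ff) (f ft) (f tf) (f tt)
    where
    swaps : ∀ a b c d → c + d + a + b ≡ a + b + c + d
    swaps = solve-∀
  translate (true , true) f = swaps (f ff) (f ft) (f tf) (f tt)
    where
    swaps : ∀ a b c d → d + c + b + a ≡ a + b + c + d
    swaps = solve-∀

kmul-comm : ∀ x y → kmul x y ≡ kmul y x
kmul-comm (a , b) (c , d) = cong₂ _,_ (Bool.xor-comm a c) (Bool.xor-comm b d)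

module _ {n : ℕ} {{_ : NonZero n}} where

  open DihedralGroup {n} using (dmul-identityˡ; dmul-identityʳ)

  infixl 8 _^ᵇ_
  _^ᵇ_ : Dih n → Bool → Dih n
  x ^ᵇ false = dunit
  x ^ᵇ true  = x

  ^ᵇ-xor : ∀ {x} → dmul x x ≡ dunit → ∀ a b → dmul (x ^ᵇ a) (x ^ᵇ b) ≡ x ^ᵇ (a xor b)
  ^ᵇ-xor {x} _ false b = dmul-identityˡ (x ^ᵇ b)
  ^ᵇ-xor {x} _ true false = dmul-identityʳ x
  ^ᵇ-xor x²≡e true true = x²≡e

  ^ᵇ-comm : ∀ {x y} → dmul x y ≡ dmul y x → ∀ a b → dmul (x ^ᵇ a) (y ^ᵇ b) ≡ dmul (y ^ᵇ b) (x ^ᵇ a)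
  ^ᵇ-comm {y = y} _ false b = trans (dmul-identityˡ (y ^ᵇ b)) (sym (dmul-identityʳ (y ^ᵇ b)))
  ^ᵇ-comm {x} _ true false = trans (dmul-identityʳ x) (sym (dmul-identityˡ x))
  ^ᵇ-comm xy≡yx true true = xy≡yx

module CommutingInvolutions {n : ℕ} {{_ : NonZero n}} (H : Subgroup {n}) {z t : Dih n}
  (z∈H : T (Subgroup.mem H z)) (t∈H : T (Subgroup.mem H t))
  (z²≡e : dmul z z ≡ dunit) (t²≡e : dmul t t ≡ dunit) (zt≡tz : dmul z t ≡ dmul t z) where

  open Subgroup H
  open DihedralGroup {n} using (dmul-assoc; dmul-identityˡ; dmul-identityʳ)

  klein : Klein → Dih n
  klein (a , b) = dmul (z ^ᵇ a) (t ^ᵇ b)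

  klein-hom : ∀ p q → klein (kmul p q) ≡ dmul (klein p) (klein q)
  klein-hom (a , b) (c , d) = sym (begin
    dmul (dmul (z ^ᵇ a) (t ^ᵇ b)) (dmul (z ^ᵇ c) (t ^ᵇ d))
      ≡⟨ dmul-assoc (z ^ᵇ a) (t ^ᵇ b) _ ⟩
    dmul (z ^ᵇ a) (dmul (t ^ᵇ b) (dmul (z ^ᵇ c) (t ^ᵇ d)))
      ≡⟨ cong (dmul (z ^ᵇ a)) (dmul-assoc (t ^ᵇ b) (z ^ᵇ c) (t ^ᵇ d)) ⟨
    dmul (z ^ᵇ a) (dmul (dmul (t ^ᵇ b) (z ^ᵇ c)) (t ^ᵇ d))
      ≡⟨ cong (λ x → dmul (z ^ᵇ a) (dmul x (t ^ᵇ d))) (^ᵇ-comm zt≡tz c b) ⟨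
    dmul (z ^ᵇ a) (dmul (dmul (z ^ᵇ c) (t ^ᵇ b)) (t ^ᵇ d))
      ≡⟨ cong (dmul (z ^ᵇ a)) (dmul-assoc (z ^ᵇ c) (t ^ᵇ b) (t ^ᵇ d)) ⟩
    dmul (z ^ᵇ a) (dmul (z ^ᵇ c) (dmul (t ^ᵇ b) (t ^ᵇ d)))
      ≡⟨ dmul-assoc (z ^ᵇ a) (z ^ᵇ c) _ ⟨
    dmul (dmul (z ^ᵇ a) (z ^ᵇ c)) (dmul (t ^ᵇ b) (t ^ᵇ d))
      ≡⟨ cong₂ dmul (^ᵇ-xor z²≡e a c) (^ᵇ-xor t²≡e b d) ⟩
    dmul (z ^ᵇ (a xor c)) (t ^ᵇ (b xor d)) ∎)
    where open ≡-Reasoning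

  ^ᵇ-mem : ∀ {x} → T (mem x) → ∀ a → T (mem (x ^ᵇ a))
  ^ᵇ-mem _ false = mem-e
  ^ᵇ-mem x∈H true = x∈H

  kleinH : Klein → Carrier H
  kleinH p@(a , b) = klein p , mem-· (^ᵇ-mem z∈H a) (^ᵇ-mem t∈H b)

  kleinH-hom : ∀ p q → kleinH (kmul p q) ≡ hmul H (kleinH p) (kleinH q)
  kleinH-hom p q = subset-≡ (klein-hom p q)

  module _ {f : Cohomology.C³ dmul} (f-cocycle : Cohomology.IsCocycle³ dmul f)
           (φ : Carrier H → Carrier H → ℤ)
           (f|H≡δφ : ∀ h₁ h₂ h₃ →
              f (proj₁ h₁) (proj₁ h₂) (proj₁ h₃) ≡ Cohomology.δ² (hmul H) φ h₁ h₂ h₃)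
    where

    open LeftInvariantSum (dihedralSum {n})
    open Averaging (dihedralSum {n}) using (averaging³)
    open Congruence size using (_≈_; ≡-modulo-multiples)

    -- δ² of the average is −size·f, and on H size·f = δ²(size·φ): E is an integral cocycle.
    F : Dih n → Dih n → ℤ
    F a b = ∑ (f a b)

    F′ φ′ E : Klein → Klein → ℤ
    F′ p q = F (klein p) (klein q)
    φ′ p q = φ (kleinH p) (kleinH q)
    E p q = F′ p q + size * φ′ p q

    E-cocycle : Averaging.IsCocycle² kleinSum E
    E-cocycle p q r = begin
      δ²ₖ E p q r
        ≡⟨ δ²-+ kmul F′ (λ u v → size * φ′ u v) p q r ⟩
      δ²ₖ F′ p q r + δ²ₖ (λ u v → size * φ′ u v) p q r
        ≡⟨ cong (_+_ (δ²ₖ F′ p q r)) (δ²-scale kmul φ′ size p q r) ⟩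
      δ²ₖ F′ p q r + size * δ²ₖ φ′ p q r
        ≡⟨ cong₂ (λ a b → a + size * b) (δ²-pullback kmul dmul klein klein-hom F p q r)
                                        (δ²-pullback kmul (hmul H) kleinH kleinH-hom φ p q r) ⟩
      Cohomology.δ² dmul F (klein p) (klein q) (klein r) + size * Cohomology.δ² (hmul H) φ (kleinH p) (kleinH q) (kleinH r)
        ≡⟨ cong₂ (λ a b → a + size * b) (averaging³ f f-cocycle (klein p) (klein q) (klein r))
                                        (sym (f|H≡δφ (kleinH p) (kleinH q) (kleinH r))) ⟩
      - (size * f (klein p) (klein q) (klein r)) + size * f (klein p) (klein q) (klein r)
        ≡⟨ ℤ.+-inverseˡ (size * f (klein p) (klein q) (klein r)) ⟩
      0ℤ ∎
      where
      open ≡-Reasoning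
      δ²ₖ : (Klein → Klein → ℤ) → Klein → Klein → Klein → ℤ
      δ²ₖ = Cohomology.δ² kmul

    averaged-comm : ∑ (f z t) ≈ ∑ (f t z)
    averaged-comm = ≡-modulo-multiples (φ (kleinH zK) (kleinH tK)) (φ (kleinH tK) (kleinH zK))
      (subst₂ (λ u v → ∑ (f u v) + size * φ (kleinH zK) (kleinH tK) ≡ ∑ (f v u) + size * φ (kleinH tK) (kleinH zK))
        (dmul-identityʳ z) (dmul-identityˡ t) E-comm)
      where
      zK tK : Klein
      zK = true , false
      tK = false , true
      E-comm : E zK tK ≡ E tK zK
      E-comm = Averaging.cocycle²-comm kleinSum kmul-comm E E-cocycle zK tK

module Rotations {n : ℕ} {{_ : NonZero n}} where

  open DihedralGroup {n}
  open Congruence (+ n)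

  rot ref : ℕ → Dih n
  rot k = modn k , false
  ref k = modn k , true

  rot-≡ : ∀ {x} k → exponent x ≈ + k → proj₂ x ≡ false → x ≡ rot k
  rot-≡ k p = ≡-byExponent (≈-trans p (≈-sym (toℤ-modn k)))

  ref-≡ : ∀ {x} k → exponent x ≈ + k → proj₂ x ≡ true → x ≡ ref k
  ref-≡ k p = ≡-byExponent (≈-trans p (≈-sym (toℤ-modn k)))

  rot-toℕ : ∀ (i : Fin n) → (i , false) ≡ rot (toℕ i)
  rot-toℕ i = rot-≡ (toℕ i) (≡⇒≈ refl) refl

  ref-toℕ : ∀ (i : Fin n) → (i , true) ≡ ref (toℕ i)
  ref-toℕ i = ref-≡ (toℕ i) (≡⇒≈ refl) refl

  private
    sum-exponent : ∀ i j → exponent (rot i) + exponent (rot j) ≈ + (i ℕ.+ j)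
    sum-exponent i j = ≈-trans (+-cong (toℤ-modn i) (toℤ-modn j)) (≡⇒≈ (sym (ℤ.pos-+ i j)))

    difference-exponent : ∀ i j → j ℕ.≤ n → exponent (rot i) - exponent (rot j) ≈ + (i ℕ.+ (n ∸ j))
    difference-exponent i j j≤n = begin
      exponent (rot i) - exponent (rot j)                       ≈⟨ -‿cong (toℤ-modn i) (toℤ-modn j) ⟩
      + i - + j                                                 ≡⟨ ℤ.+-identityˡ (+ i - + j) ⟨
      0ℤ + (+ i - + j)                                          ≈⟨ +-congʳ (+ i - + j) modulus≈0 ⟨
      + n + (+ i - + j)                                         ≡⟨ rearrange (+ n) (+ i) (+ j) ⟩
      + i + (+ n - + j)                                         ≡⟨ cong (_+_ (+ i)) (pos-∸ j≤n) ⟨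
      + i + + (n ∸ j)                                           ≡⟨ ℤ.pos-+ i (n ∸ j) ⟨
      + (i ℕ.+ (n ∸ j))                                         ∎
      where
      open ≈-Reasoning
      rearrange : ∀ n i j → n + (i - j) ≡ i + (n - j)
      rearrange = solve-∀

  rot·rot : ∀ i j → dmul (rot i) (rot j) ≡ rot (i ℕ.+ j)
  rot·rot i j = rot-≡ (i ℕ.+ j) (≈-trans (exponent-dmul (rot i) (rot j)) (sum-exponent i j)) refl

  rot·ref : ∀ i j → dmul (rot i) (ref j) ≡ ref (i ℕ.+ j)
  rot·ref i j = ref-≡ (i ℕ.+ j) (≈-trans (exponent-dmul (rot i) (ref j)) (sum-exponent i j)) refl

  ref·rot : ∀ i j → j ℕ.≤ n → dmul (ref i) (rot j) ≡ ref (i ℕ.+ (n ∸ j))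
  ref·rot i j j≤n = ref-≡ _ (≈-trans (exponent-dmul (ref i) (rot j)) (difference-exponent i j j≤n)) refl

  rot-∸n : ∀ k → n ℕ.≤ k → rot k ≡ rot (k ∸ n)
  rot-∸n k n≤k = rot-≡ (k ∸ n) (begin
    exponent (rot k)       ≈⟨ toℤ-modn k ⟩
    + k                    ≡⟨ cong +_ (ℕ.m+[n∸m]≡n n≤k) ⟨
    + (n ℕ.+ (k ∸ n))      ≡⟨ ℤ.pos-+ n (k ∸ n) ⟩
    + n + + (k ∸ n)        ≈⟨ +-congʳ (+ (k ∸ n)) modulus≈0 ⟩
    0ℤ + + (k ∸ n)         ≡⟨ ℤ.+-identityˡ _ ⟩
    + (k ∸ n)              ∎) refl
    where open ≈-Reasoning

  exponent-rot-< : ∀ {k} → k ℕ.< n → exponent (rot k) ≡ + k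
  exponent-rot-< {k} k<n = cong +_ (trans (Fin.toℕ-fromℕ< (m%n<n k n)) (m<n⇒m%n≡m k<n))

  exponent-rot-≥ : ∀ {k} → n ℕ.≤ k → k ℕ.< n ℕ.+ n → exponent (rot k) ≡ + k - + n
  exponent-rot-≥ {k} n≤k k<2n = begin
    exponent (rot k)       ≡⟨ cong exponent (rot-∸n k n≤k) ⟩
    exponent (rot (k ∸ n)) ≡⟨ exponent-rot-< (ℕ.+-cancelˡ-< n (k ∸ n) n k∸n+n<2n) ⟩
    + (k ∸ n)              ≡⟨ pos-∸ n≤k ⟩
    + k - + n              ∎
    where
    open ≡-Reasoning
    k∸n+n<2n : n ℕ.+ (k ∸ n) ℕ.< n ℕ.+ n
    k∸n+n<2n = subst (ℕ._< n ℕ.+ n) (sym (ℕ.m+[n∸m]≡n n≤k)) k<2n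

carry : Bool → Bool → ℤ
carry true true = + 1
carry _    _    = 0ℤ

carry-cocycle : ∀ a b c → carry b c - carry (a xor b) c + carry a (b xor c) - carry a b ≡ 0ℤ
carry-cocycle false false false = refl
carry-cocycle false false true  = refl
carry-cocycle false true  false = refl
carry-cocycle false true  true  = refl
carry-cocycle true  false false = refl
carry-cocycle true  false true  = refl
carry-cocycle true  true  false = refl
carry-cocycle true  true  true  = refl

module _ {n : ℕ} {{_ : NonZero n}} where

  open Cohomology (dmul {n})
  open DihedralGroup {n} using (flag-dmul)

  reflectionCarry : C²
  reflectionCarry x y = carry (proj₂ x) (proj₂ y)

  reflectionCarry-cocycle : ∀ x y z → δ² reflectionCarry x y z ≡ 0ℤ
  reflectionCarry-cocycle x y z =
    trans (cong₂ (λ a b → carry (proj₂ y) (proj₂ z) - carry a (proj₂ z) + carry (proj₂ x) b - carry (proj₂ x) (proj₂ y))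
                 (flag-dmul x y) (flag-dmul y z))
          (carry-cocycle (proj₂ x) (proj₂ y) (proj₂ z))

module HalfTurn {n : ℕ} {{_ : NonZero n}} (h : ℕ) (n≡h+h : n ≡ h ℕ.+ h) where

  open Rotations {n}
  open DihedralGroup {n} using (exponent; dmul-assoc)
  open Cohomology (dmul {n})

  -- Δ is half the coboundary of the exponent map Dₙ → ℤ (not a homomorphism),
  -- hence an integral 2-cocycle.
  Δ : C²
  Δ (i , false) (j , _) with toℕ i ℕ.+ toℕ j ℕ.<? n
  ... | yes _ = 0ℤ
  ... | no  _ = + h
  Δ (i , true) (j , _) with toℕ j ℕ.≤? toℕ i
  ... | yes _ = + toℕ j
  ... | no  _ = + toℕ j - + h

  private
    δ¹-exponent : ∀ x y {e} → exponent (dmul x y) ≡ e → δ¹ dmul exponent x y ≡ exponent y - e + exponent x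
    δ¹-exponent x y eq = cong (λ e → exponent y - e + exponent x) eq

    n≡h+hℤ : + n ≡ + h + + h
    n≡h+hℤ = trans (cong +_ n≡h+h) (ℤ.pos-+ h h)

  twice-Δ : ∀ x y → + 2 * Δ x y ≡ δ¹ dmul exponent x y
  twice-Δ (i , false) (j , c) with toℕ i ℕ.+ toℕ j ℕ.<? n
  ... | yes i+j<n = sym (trans (δ¹-exponent (i , false) (j , c)
          (trans (exponent-rot-< i+j<n) (ℤ.pos-+ (toℕ i) (toℕ j)))) (ring (+ toℕ i) (+ toℕ j)))
    where
    ring : ∀ i j → j - (i + j) + i ≡ + 2 * 0ℤ
    ring = solve-∀
  ... | no i+j≮n = sym (trans (δ¹-exponent (i , false) (j , c)
          (trans (exponent-rot-≥ (ℕ.≮⇒≥ i+j≮n) (ℕ.+-mono-< (Fin.toℕ<n i) (Fin.toℕ<n j)))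
                 (cong₂ _-_ (ℤ.pos-+ (toℕ i) (toℕ j)) n≡h+hℤ))) (ring (+ toℕ i) (+ toℕ j) (+ h)))
    where
    ring : ∀ i j h → j - (i + j - (h + h)) + i ≡ + 2 * h
    ring = solve-∀
  twice-Δ (i , true) (j , c) with toℕ j ℕ.≤? toℕ i
  ... | yes j≤i = sym (trans (δ¹-exponent (i , true) (j , c)
          (trans (exponent-rot-≥ n≤k k<2n) (cong (_- + n) (i+[n-j]ℤ)))) (ring (+ toℕ i) (+ toℕ j) (+ n)))
    where
    j≤n : toℕ j ℕ.≤ n
    j≤n = ℕ.<⇒≤ (Fin.toℕ<n j)
    n≤k : n ℕ.≤ toℕ i ℕ.+ (n ∸ toℕ j)
    n≤k = subst (ℕ._≤ toℕ i ℕ.+ (n ∸ toℕ j)) (ℕ.m+[n∸m]≡n j≤n) (ℕ.+-monoˡ-≤ (n ∸ toℕ j) j≤i)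
    k<2n : toℕ i ℕ.+ (n ∸ toℕ j) ℕ.< n ℕ.+ n
    k<2n = ℕ.+-mono-<-≤ (Fin.toℕ<n i) (ℕ.m∸n≤m n (toℕ j))
    i+[n-j]ℤ : + (toℕ i ℕ.+ (n ∸ toℕ j)) ≡ + toℕ i + (+ n - + toℕ j)
    i+[n-j]ℤ = trans (ℤ.pos-+ (toℕ i) (n ∸ toℕ j)) (cong (_+_ (+ toℕ i)) (pos-∸ j≤n))
    ring : ∀ i j n → j - (i + (n - j) - n) + i ≡ + 2 * j
    ring = solve-∀
  ... | no j≰i = sym (trans (δ¹-exponent (i , true) (j , c)
          (trans (exponent-rot-< k<n) i+[n-j]ℤ)) (ring (+ toℕ i) (+ toℕ j) (+ h)))
    where
    j≤n : toℕ j ℕ.≤ n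
    j≤n = ℕ.<⇒≤ (Fin.toℕ<n j)
    k<n : toℕ i ℕ.+ (n ∸ toℕ j) ℕ.< n
    k<n = subst (toℕ i ℕ.+ (n ∸ toℕ j) ℕ.<_) (ℕ.m+[n∸m]≡n j≤n) (ℕ.+-monoˡ-< (n ∸ toℕ j) (ℕ.≰⇒> j≰i))
    i+[n-j]ℤ : + (toℕ i ℕ.+ (n ∸ toℕ j)) ≡ + toℕ i + (+ h + + h - + toℕ j)
    i+[n-j]ℤ = trans (ℤ.pos-+ (toℕ i) (n ∸ toℕ j))
                     (cong (_+_ (+ toℕ i)) (trans (pos-∸ j≤n) (cong (_- + toℕ j) n≡h+hℤ)))
    ring : ∀ i j h → j - (i + (h + h - j)) + i ≡ + 2 * (j - h)
    ring = solve-∀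

  Δ-cocycle : ∀ x y z → δ² Δ x y z ≡ 0ℤ
  Δ-cocycle x y z = ℤ.*-cancelˡ-≡ (+ 2) (δ² Δ x y z) 0ℤ (begin
    + 2 * δ² Δ x y z                      ≡⟨ δ²-scale dmul Δ (+ 2) x y z ⟨
    δ² (λ u v → + 2 * Δ u v) x y z        ≡⟨ δ²-cong dmul twice-Δ x y z ⟩
    δ² (δ¹ dmul exponent) x y z           ≡⟨ δ²∘δ¹ dmul dmul-assoc exponent x y z ⟩
    0ℤ                                    ≡⟨ ℤ.*-zeroʳ (+ 2) ⟨
    + 2 * 0ℤ                              ∎)
    where open ≡-Reasoning

  0<h : 0 ℕ.< h
  0<h = ℕ.n≢0⇒n>0 (λ h≡0 → ℕ.≢-nonZero⁻¹ n (trans n≡h+h (cong (λ m → m ℕ.+ m) h≡0)))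

  h<n : h ℕ.< n
  h<n = subst (h ℕ.<_) (sym n≡h+h) (ℕ.m<m+n h 0<h)

  n∸h≡h : n ∸ h ≡ h
  n∸h≡h = trans (cong (_∸ h) n≡h+h) (ℕ.m+n∸m≡n h h)

  rot-h-central : ∀ x → dmul (rot h) x ≡ dmul x (rot h)
  rot-h-central (i , false) = begin
    dmul (rot h) (i , false)          ≡⟨ cong (dmul (rot h)) (rot-toℕ i) ⟩
    dmul (rot h) (rot (toℕ i))        ≡⟨ rot·rot h (toℕ i) ⟩
    rot (h ℕ.+ toℕ i)                 ≡⟨ cong rot (ℕ.+-comm h (toℕ i)) ⟩
    rot (toℕ i ℕ.+ h)                 ≡⟨ rot·rot (toℕ i) h ⟨
    dmul (rot (toℕ i)) (rot h)        ≡⟨ cong (λ x → dmul x (rot h)) (rot-toℕ i) ⟨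
    dmul (i , false) (rot h)          ∎
    where open ≡-Reasoning
  rot-h-central (i , true) = begin
    dmul (rot h) (i , true)           ≡⟨ cong (dmul (rot h)) (ref-toℕ i) ⟩
    dmul (rot h) (ref (toℕ i))        ≡⟨ rot·ref h (toℕ i) ⟩
    ref (h ℕ.+ toℕ i)                 ≡⟨ cong ref (trans (ℕ.+-comm h (toℕ i)) (cong (toℕ i ℕ.+_) (sym n∸h≡h))) ⟩
    ref (toℕ i ℕ.+ (n ∸ h))           ≡⟨ ref·rot (toℕ i) h (ℕ.<⇒≤ h<n) ⟨
    dmul (ref (toℕ i)) (rot h)        ≡⟨ cong (λ x → dmul x (rot h)) (ref-toℕ i) ⟨
    dmul (i , true) (rot h)           ∎
    where open ≡-Reasoning

  rot-h-involution : dmul (rot h) (rot h) ≡ dunit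
  rot-h-involution = begin
    dmul (rot h) (rot h)   ≡⟨ rot·rot h h ⟩
    rot (h ℕ.+ h)          ≡⟨ cong rot (sym n≡h+h) ⟩
    rot n                  ≡⟨ rot-∸n n ℕ.≤-refl ⟩
    rot (n ∸ n)            ≡⟨ cong rot (ℕ.n∸n≡0 n) ⟩
    dunit                  ∎
    where open ≡-Reasoning

  rot-h≢dunit : rot h ≢ dunit
  rot-h≢dunit eq = ℕ.<⇒≢ 0<h (sym (ℤ.+-injective (begin
    + h                ≡⟨ exponent-rot-< h<n ⟨
    exponent (rot h)   ≡⟨ cong exponent eq ⟩
    exponent (rot 0)   ≡⟨ exponent-rot-< (ℕ.<-trans 0<h h<n) ⟩
    + 0                ∎)))
    where open ≡-Reasoning

  private
    exponent-square≡0 : ∀ (c : Fin n) → dmul (c , false) (c , false) ≡ dunit → exponent (rot (toℕ c ℕ.+ toℕ c)) ≡ + 0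
    exponent-square≡0 c c²≡e = begin
      exponent (rot (toℕ c ℕ.+ toℕ c))              ≡⟨ cong exponent (rot·rot (toℕ c) (toℕ c)) ⟨
      exponent (dmul (rot (toℕ c)) (rot (toℕ c)))   ≡⟨ cong (λ x → exponent (dmul x x)) (rot-toℕ c) ⟨
      exponent (dmul (c , false) (c , false))       ≡⟨ cong exponent c²≡e ⟩
      exponent (rot 0)                              ≡⟨ exponent-rot-< (ℕ.<-trans 0<h h<n) ⟩
      + 0                                           ∎
      where open ≡-Reasoning

  involution-rotation : ∀ (c : Fin n) → dmul (c , false) (c , false) ≡ dunit → (c , false) ≢ dunit → (c , false) ≡ rot h
  involution-rotation c c²≡e c≢e with toℕ c ℕ.+ toℕ c ℕ.<? n
  ... | yes 2c<n = contradiction (trans (rot-toℕ c) (cong rot c≡0)) c≢e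
    where
    c≡0 : toℕ c ≡ 0
    c≡0 = ℕ.m+n≡0⇒m≡0 (toℕ c) (ℤ.+-injective (trans (sym (exponent-rot-< 2c<n)) (exponent-square≡0 c c²≡e)))
  ... | no 2c≮n = trans (rot-toℕ c) (cong rot c≡h)
    where
    n≤2c : n ℕ.≤ toℕ c ℕ.+ toℕ c
    n≤2c = ℕ.≮⇒≥ 2c≮n
    2c∸n≡0 : toℕ c ℕ.+ toℕ c ∸ n ≡ 0
    2c∸n≡0 = ℤ.+-injective (begin
      + (toℕ c ℕ.+ toℕ c ∸ n)            ≡⟨ pos-∸ n≤2c ⟩
      + (toℕ c ℕ.+ toℕ c) - + n          ≡⟨ exponent-rot-≥ n≤2c (ℕ.+-mono-< (Fin.toℕ<n c) (Fin.toℕ<n c)) ⟨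
      exponent (rot (toℕ c ℕ.+ toℕ c))   ≡⟨ exponent-square≡0 c c²≡e ⟩
      + 0                                ∎)
      where open ≡-Reasoning
    c≡h : toℕ c ≡ h
    c≡h = ℕ.*-cancelˡ-≡ (toℕ c) h 2 (begin
      2 ℕ.* toℕ c            ≡⟨ cong (toℕ c ℕ.+_) (ℕ.+-identityʳ (toℕ c)) ⟩
      toℕ c ℕ.+ toℕ c        ≡⟨ ℕ.≤-antisym (ℕ.m∸n≡0⇒m≤n 2c∸n≡0) n≤2c ⟩
      n                      ≡⟨ n≡h+h ⟩
      h ℕ.+ h                ≡⟨ cong (h ℕ.+_) (ℕ.+-identityʳ h) ⟨
      2 ℕ.* h                ∎)
      where open ≡-Reasoning

module NormalForm {n : ℕ} {{_ : NonZero n}} (h : ℕ) (n≡h+h : n ≡ h ℕ.+ h) (M : ℤ) where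

  open Rotations {n}
  open HalfTurn h n≡h+h
  open DihedralGroup {n} using (dmul-assoc; dmul-identityˡ; dmul-identityʳ; dinv-inverseʳ)
  open Cohomology (dmul {n})
  open Congruence M

  e r s : Dih n
  e = dunit
  r = rot 1
  s = ref 0

  rot·s : ∀ m → dmul (rot m) s ≡ ref m
  rot·s m = trans (rot·ref m 0) (cong ref (ℕ.+-identityʳ m))

  IsCocycle²-mod : C² → Set
  IsCocycle²-mod u = ∀ x y z → δ² u x y z ≈ 0ℤ

  module _ {v : C²} (v-cocycle : IsCocycle²-mod v) where

    isolate-left : ∀ x y z {xy yz} → dmul x y ≡ xy → dmul y z ≡ yz → v xy z ≈ v y z + v x yz - v x y
    isolate-left x y z refl refl = isolate₂ {v y z} {v (dmul x y) z} {v x (dmul y z)} {v x y} (v-cocycle x y z)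

    isolate-right : ∀ x y z {xy yz} → dmul x y ≡ xy → dmul y z ≡ yz → v x yz ≈ v xy z + v x y - v y z
    isolate-right x y z refl refl = isolate₃ {v y z} {v (dmul x y) z} {v x (dmul y z)} {v x y} (v-cocycle x y z)

    unitˡ : ∀ y → v e y ≈ v e e
    unitˡ y = ≈-trans (isolate-right e e y (dmul-identityˡ e) (dmul-identityˡ y))
                      (≡⇒≈ (cancel (v e y) (v e e)))
      where
      cancel : ∀ a b → a + b - a ≡ b
      cancel = solve-∀

    unitʳ : ∀ x → v x e ≈ v e e
    unitʳ x = ≈-trans (isolate-left x e e (dmul-identityʳ x) (dmul-identityˡ e))
                      (≡⇒≈ (cancel (v e e) (v x e)))
      where
      cancel : ∀ a b → a + b - b ≡ a
      cancel = solve-∀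

  module Normalised (w : C²) (w-cocycle : IsCocycle²-mod w)
    (w-e-left : ∀ y → w e y ≈ 0ℤ) (w-e-right : ∀ x → w x e ≈ 0ℤ)
    (w-r-rot : ∀ k → suc k ℕ.< n → w r (rot k) ≈ 0ℤ) (w-rot-s : ∀ m → w (rot m) s ≈ 0ℤ) where

    A B k : ℤ
    A = w r (rot (n ∸ 1))
    B = w s s
    k = w s r + A

    G : ℕ → ℤ
    G j = w s (rot j)

    w-left : ∀ x y z {xy yz} → dmul x y ≡ xy → dmul y z ≡ yz → w xy z ≈ w y z + w x yz - w x y
    w-left = isolate-left {w} w-cocycle

    w-right : ∀ x y z {xy yz} → dmul x y ≡ xy → dmul y z ≡ yz → w x yz ≈ w xy z + w x y - w y z
    w-right = isolate-right {w} w-cocycle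

    w-rot-step : ∀ i j → suc i ℕ.< n → w (rot (suc i)) (rot j) ≈ w (rot i) (rot j) + w r (rot (i ℕ.+ j))
    w-rot-step i j 1+i<n = begin
      w (rot (suc i)) (rot j)
        ≈⟨ w-left r (rot i) (rot j) (rot·rot 1 i) (rot·rot i j) ⟩
      w (rot i) (rot j) + w r (rot (i ℕ.+ j)) - w r (rot i)
        ≈⟨ -‿congˡ (w (rot i) (rot j) + w r (rot (i ℕ.+ j))) (w-r-rot i 1+i<n) ⟩
      w (rot i) (rot j) + w r (rot (i ℕ.+ j)) - 0ℤ
        ≡⟨ ℤ.+-identityʳ _ ⟩
      w (rot i) (rot j) + w r (rot (i ℕ.+ j))                        ∎
      where open ≈-Reasoning

    private
      wrap-around : ∀ {i j} → suc (suc i) ℕ.≤ n → j ℕ.< n → n ℕ.≤ i ℕ.+ j → suc (i ℕ.+ j ∸ n) ℕ.< n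
      wrap-around {i} {j} 2+i≤n j<n n≤i+j = ℕ.+-cancelʳ-≤ n _ _ (begin
        suc (suc (i ℕ.+ j ∸ n)) ℕ.+ n   ≡⟨ cong (λ m → suc (suc m)) (ℕ.m∸n+n≡m n≤i+j) ⟩
        suc (suc i) ℕ.+ j               ≤⟨ ℕ.+-mono-≤ 2+i≤n (ℕ.<⇒≤ j<n) ⟩
        n ℕ.+ n                         ∎)
        where open ℕ.≤-Reasoning

    w-rot-rot-< : ∀ i j → i ℕ.+ j ℕ.< n → w (rot i) (rot j) ≈ 0ℤ
    w-rot-rot-≥ : ∀ i j → i ℕ.< n → j ℕ.< n → n ℕ.≤ i ℕ.+ j → w (rot i) (rot j) ≈ A

    w-rot-rot-< zero    j _       = w-e-left (rot j)
    w-rot-rot-< (suc i) j 1+i+j<n = begin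
      w (rot (suc i)) (rot j)
        ≈⟨ w-rot-step i j (ℕ.≤-<-trans (ℕ.s≤s (ℕ.m≤m+n i j)) 1+i+j<n) ⟩
      w (rot i) (rot j) + w r (rot (i ℕ.+ j))
        ≈⟨ +-cong (w-rot-rot-< i j (ℕ.<-trans (ℕ.n<1+n _) 1+i+j<n)) (w-r-rot (i ℕ.+ j) 1+i+j<n) ⟩
      0ℤ ∎
      where open ≈-Reasoning

    w-rot-rot-≥ zero    j _     j<n n≤j     = contradiction n≤j (ℕ.<⇒≱ j<n)
    w-rot-rot-≥ (suc i) j 1+i<n j<n n≤1+i+j with i ℕ.+ j ℕ.<? n
    ... | yes i+j<n = begin
      w (rot (suc i)) (rot j)                   ≈⟨ w-rot-step i j 1+i<n ⟩
      w (rot i) (rot j) + w r (rot (i ℕ.+ j))   ≈⟨ +-congʳ (w r (rot (i ℕ.+ j))) (w-rot-rot-< i j i+j<n) ⟩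
      0ℤ + w r (rot (i ℕ.+ j))                  ≡⟨ ℤ.+-identityˡ _ ⟩
      w r (rot (i ℕ.+ j))                       ≡⟨ cong (λ m → w r (rot m)) (cong ℕ.pred (ℕ.≤-antisym i+j<n n≤1+i+j)) ⟩
      A                                         ∎
      where open ≈-Reasoning
    ... | no i+j≮n = begin
      w (rot (suc i)) (rot j)
        ≈⟨ w-rot-step i j 1+i<n ⟩
      w (rot i) (rot j) + w r (rot (i ℕ.+ j))
        ≈⟨ +-congʳ (w r (rot (i ℕ.+ j))) (w-rot-rot-≥ i j (ℕ.<-trans (ℕ.n<1+n i) 1+i<n) j<n n≤i+j) ⟩
      A + w r (rot (i ℕ.+ j))
        ≡⟨ cong (λ x → A + w r x) (rot-∸n (i ℕ.+ j) n≤i+j) ⟩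
      A + w r (rot (i ℕ.+ j ∸ n))
        ≈⟨ +-congˡ A (w-r-rot (i ℕ.+ j ∸ n) (wrap-around 1+i<n j<n n≤i+j)) ⟩
      A + 0ℤ
        ≡⟨ ℤ.+-identityʳ A ⟩
      A ∎
      where
      open ≈-Reasoning
      n≤i+j : n ℕ.≤ i ℕ.+ j
      n≤i+j = ℕ.≮⇒≥ i+j≮n

    w-rot-ref : ∀ i j → w (rot i) (ref j) ≈ w (rot i) (rot j)
    w-rot-ref i j = begin
      w (rot i) (ref j)
        ≈⟨ w-right (rot i) (rot j) s (rot·rot i j) (rot·s j) ⟩
      w (rot (i ℕ.+ j)) s + w (rot i) (rot j) - w (rot j) s
        ≈⟨ -‿cong (+-congʳ (w (rot i) (rot j)) (w-rot-s (i ℕ.+ j))) (w-rot-s j) ⟩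
      0ℤ + w (rot i) (rot j) - 0ℤ
        ≡⟨ cancel (w (rot i) (rot j)) ⟩
      w (rot i) (rot j) ∎
      where
      open ≈-Reasoning
      cancel : ∀ a → 0ℤ + a - 0ℤ ≡ a
      cancel = solve-∀

    w-ref-s : ∀ m → w (ref m) s ≈ B
    w-ref-s m = begin
      w (ref m) s                               ≈⟨ w-left (rot m) s s (rot·s m) (dinv-inverseʳ s) ⟩
      B + w (rot m) e - w (rot m) s             ≈⟨ -‿cong (+-congˡ B (w-e-right (rot m))) (w-rot-s m) ⟩
      B + 0ℤ - 0ℤ                               ≡⟨ cancel B ⟩
      B                                         ∎
      where
      open ≈-Reasoning
      cancel : ∀ a → a + 0ℤ - 0ℤ ≡ a
      cancel = solve-∀

    w-ref-rot : ∀ i j → j ℕ.≤ n → w (ref i) (rot j) ≈ G j + w (rot i) (rot (n ∸ j))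
    w-ref-rot i j j≤n = begin
      w (ref i) (rot j)                                   ≈⟨ w-left (rot i) s (rot j) (rot·s i) (ref·rot 0 j j≤n) ⟩
      G j + w (rot i) (ref (n ∸ j)) - w (rot i) s         ≈⟨ -‿cong (+-congˡ (G j) (w-rot-ref i (n ∸ j))) (w-rot-s i) ⟩
      G j + w (rot i) (rot (n ∸ j)) - 0ℤ                  ≡⟨ ℤ.+-identityʳ _ ⟩
      G j + w (rot i) (rot (n ∸ j))                       ∎
      where open ≈-Reasoning

    w-ref-rot-< : ∀ i j → i ℕ.< j → j ℕ.< n → w (ref i) (rot j) ≈ G j
    w-ref-rot-< i j i<j j<n = begin
      w (ref i) (rot j)                   ≈⟨ w-ref-rot i j (ℕ.<⇒≤ j<n) ⟩
      G j + w (rot i) (rot (n ∸ j))       ≈⟨ +-congˡ (G j) (w-rot-rot-< i (n ∸ j) i+[n∸j]<n) ⟩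
      G j + 0ℤ                            ≡⟨ ℤ.+-identityʳ (G j) ⟩
      G j                                 ∎
      where
      open ≈-Reasoning
      i+[n∸j]<n : i ℕ.+ (n ∸ j) ℕ.< n
      i+[n∸j]<n = subst (i ℕ.+ (n ∸ j) ℕ.<_) (ℕ.m+[n∸m]≡n (ℕ.<⇒≤ j<n)) (ℕ.+-monoˡ-< (n ∸ j) i<j)

    w-ref-rot-≥ : ∀ i j → 0 ℕ.< j → j ℕ.≤ i → i ℕ.< n → w (ref i) (rot j) ≈ G j + A
    w-ref-rot-≥ i j 0<j j≤i i<n = ≈-trans (w-ref-rot i j j≤n)
      (+-congˡ (G j) (w-rot-rot-≥ i (n ∸ j) i<n (ℕ.∸-monoʳ-< 0<j j≤n) n≤i+[n∸j]))
      where
      j≤n : j ℕ.≤ n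
      j≤n = ℕ.≤-trans j≤i (ℕ.<⇒≤ i<n)
      n≤i+[n∸j] : n ℕ.≤ i ℕ.+ (n ∸ j)
      n≤i+[n∸j] = subst (ℕ._≤ i ℕ.+ (n ∸ j)) (ℕ.m+[n∸m]≡n j≤n) (ℕ.+-monoˡ-≤ (n ∸ j) j≤i)

    -- Each step from s rʲ to s rʲ⁺¹ adds k: the value w s r plus the carry A.
    G≈ : ∀ j → suc j ℕ.< n → G (suc j) ≈ + suc j * k - A
    G≈ zero _ = ≡⇒≈ (unfold (w s r) A)
      where
      unfold : ∀ a A → a ≡ + 1 * (a + A) - A
      unfold = solve-∀
    G≈ (suc j) 2+j<n = begin
      G (suc (suc j))
        ≈⟨ w-right s r (rot (suc j)) (ref·rot 0 1 1≤n) (rot·rot 1 (suc j)) ⟩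
      w (ref (n ∸ 1)) (rot (suc j)) + w s r - w r (rot (suc j))
        ≈⟨ -‿cong (+-congʳ (w s r) (w-ref-rot-≥ (n ∸ 1) (suc j) ℕ.z<s 1+j≤n-1 n-1<n)) (w-r-rot (suc j) 2+j<n) ⟩
      G (suc j) + A + w s r - 0ℤ
        ≈⟨ +-congʳ (- 0ℤ) (+-congʳ (w s r) (+-congʳ A (G≈ j (ℕ.<-trans (ℕ.n<1+n _) 2+j<n)))) ⟩
      + suc j * k - A + A + w s r - 0ℤ
        ≡⟨ collect (+ suc j) (w s r) A ⟩
      (+ 1 + + suc j) * k - A
        ≡⟨ cong (λ m → m * k - A) (ℤ.pos-+ 1 (suc j)) ⟨
      + suc (suc j) * k - A                                        ∎
      where
      open ≈-Reasoning
      1≤n : 1 ℕ.≤ n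
      1≤n = ℕ.<-trans (ℕ.s≤s ℕ.z≤n) 2+j<n
      n-1<n : n ∸ 1 ℕ.< n
      n-1<n = ℕ.∸-monoʳ-< ℕ.z<s 1≤n
      1+j≤n-1 : suc j ℕ.≤ n ∸ 1
      1+j≤n-1 = ℕ.≤-pred (subst (suc (suc j) ℕ.≤_) (sym (ℕ.m+[n∸m]≡n 1≤n)) (ℕ.<⇒≤ 2+j<n))
      collect : ∀ J a A → J * (a + A) - A + A + a - 0ℤ ≡ (+ 1 + J) * (a + A) - A
      collect = solve-∀

    w-ref-ref : ∀ i j → j ℕ.≤ n → w (ref i) (ref j) ≈ w (ref i) (rot j) + B
    w-ref-ref i j j≤n = begin
      w (ref i) (ref j)
        ≈⟨ w-right (ref i) (rot j) s (ref·rot i j j≤n) (rot·s j) ⟩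
      w (ref (i ℕ.+ (n ∸ j))) s + w (ref i) (rot j) - w (rot j) s
        ≈⟨ -‿cong (+-congʳ (w (ref i) (rot j)) (w-ref-s _)) (w-rot-s j) ⟩
      B + w (ref i) (rot j) - 0ℤ
        ≡⟨ swap B (w (ref i) (rot j)) ⟩
      w (ref i) (rot j) + B ∎
      where
      open ≈-Reasoning
      swap : ∀ b a → b + a - 0ℤ ≡ a + b
      swap = solve-∀

    G≈-pos : ∀ j → 0 ℕ.< j → j ℕ.< n → G j ≈ + j * k - A
    G≈-pos (suc j) _ = G≈ j

    w-ref-rot-≤ : ∀ i j → j ℕ.≤ i → i ℕ.< n → w (ref i) (rot j) ≈ + j * k
    w-ref-rot-≤ i zero    _   _   = ≈-trans (w-e-right (ref i)) (≡⇒≈ (sym (ℤ.*-zeroˡ k)))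
    w-ref-rot-≤ i (suc j) j<i i<n = begin
      w (ref i) (rot (suc j))       ≈⟨ w-ref-rot-≥ i (suc j) ℕ.z<s j<i i<n ⟩
      G (suc j) + A                 ≈⟨ +-congʳ A (G≈ j (ℕ.≤-<-trans j<i i<n)) ⟩
      + suc j * k - A + A           ≡⟨ cancel (+ suc j * k) A ⟩
      + suc j * k                   ∎
      where
      open ≈-Reasoning
      cancel : ∀ a A → a - A + A ≡ a
      cancel = solve-∀

    w-rot : ∀ (i j : Fin n) c → w (i , false) (j , c) ≈ w (rot (toℕ i)) (rot (toℕ j))
    w-rot i j false = ≡⇒≈ (cong₂ w (rot-toℕ i) (rot-toℕ j))
    w-rot i j true  = ≈-trans (≡⇒≈ (cong₂ w (rot-toℕ i) (ref-toℕ j))) (w-rot-ref (toℕ i) (toℕ j))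

    Δ-flag : ∀ x (j : Fin n) c → Δ x (j , c) ≡ Δ x (j , false)
    Δ-flag (i , false) j c with toℕ i ℕ.+ toℕ j ℕ.<? n
    ... | yes _ = refl
    ... | no  _ = refl
    Δ-flag (i , true) j c with toℕ j ℕ.≤? toℕ i
    ... | yes _ = refl
    ... | no  _ = refl

    w-normal : A ≈ + h * k → ∀ x y → w x y ≈ k * Δ x y + B * reflectionCarry x y
    w-normal A≈hk (i , false) (j , c) with toℕ i ℕ.+ toℕ j ℕ.<? n
    ... | yes i+j<n = ≈-trans (w-rot i j c) (≈-trans (w-rot-rot-< (toℕ i) (toℕ j) i+j<n) (≡⇒≈ (sym (zeros k B))))
      where
      zeros : ∀ k B → k * 0ℤ + B * 0ℤ ≡ 0ℤ
      zeros = solve-∀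
    ... | no i+j≮n = begin
      w (i , false) (j , c)              ≈⟨ w-rot i j c ⟩
      w (rot (toℕ i)) (rot (toℕ j))      ≈⟨ w-rot-rot-≥ (toℕ i) (toℕ j) (Fin.toℕ<n i) (Fin.toℕ<n j) (ℕ.≮⇒≥ i+j≮n) ⟩
      A                                  ≈⟨ A≈hk ⟩
      + h * k                            ≡⟨ reorder k B (+ h) ⟨
      k * + h + B * 0ℤ                   ∎
      where
      open ≈-Reasoning
      reorder : ∀ k B h → k * h + B * 0ℤ ≡ h * k
      reorder = solve-∀
    w-normal A≈hk (i , true) (j , false) with toℕ j ℕ.≤? toℕ i
    ... | yes j≤i = begin
      w (i , true) (j , false)           ≡⟨ cong₂ w (ref-toℕ i) (rot-toℕ j) ⟩
      w (ref (toℕ i)) (rot (toℕ j))      ≈⟨ w-ref-rot-≤ (toℕ i) (toℕ j) j≤i (Fin.toℕ<n i) ⟩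
      + toℕ j * k                        ≡⟨ reorder k B (+ toℕ j) ⟨
      k * + toℕ j + B * 0ℤ               ∎
      where
      open ≈-Reasoning
      reorder : ∀ k B j → k * j + B * 0ℤ ≡ j * k
      reorder = solve-∀
    ... | no j≰i = begin
      w (i , true) (j , false)         ≡⟨ cong₂ w (ref-toℕ i) (rot-toℕ j) ⟩
      w (ref (toℕ i)) (rot (toℕ j))    ≈⟨ w-ref-rot-< (toℕ i) (toℕ j) (ℕ.≰⇒> j≰i) (Fin.toℕ<n j) ⟩
      G (toℕ j)                        ≈⟨ G≈-pos (toℕ j) (ℕ.≤-<-trans ℕ.z≤n (ℕ.≰⇒> j≰i)) (Fin.toℕ<n j) ⟩
      + toℕ j * k - A                  ≈⟨ -‿congˡ (+ toℕ j * k) A≈hk ⟩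
      + toℕ j * k - + h * k            ≡⟨ reorder k B (+ toℕ j) (+ h) ⟩
      k * (+ toℕ j - + h) + B * 0ℤ     ∎
      where
      open ≈-Reasoning
      reorder : ∀ k B j h → j * k - h * k ≡ k * (j - h) + B * 0ℤ
      reorder = solve-∀
    w-normal A≈hk x@(i , true) (j , true) = begin
      w (i , true) (j , true)                             ≡⟨ cong₂ w (ref-toℕ i) (ref-toℕ j) ⟩
      w (ref (toℕ i)) (ref (toℕ j))                       ≈⟨ w-ref-ref (toℕ i) (toℕ j) (ℕ.<⇒≤ (Fin.toℕ<n j)) ⟩
      w (ref (toℕ i)) (rot (toℕ j)) + B                   ≡⟨ cong (λ y → y + B) (cong₂ w (ref-toℕ i) (rot-toℕ j)) ⟨
      w x (j , false) + B                                 ≈⟨ +-congʳ B (w-normal A≈hk x (j , false)) ⟩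
      k * Δ x (j , false) + B * 0ℤ + B                    ≡⟨ reorder k (Δ x (j , false)) B ⟩
      k * Δ x (j , false) + B * + 1                       ≡⟨ cong (λ d → k * d + B * + 1) (Δ-flag x j true) ⟨
      k * Δ x (j , true) + B * + 1                        ∎
      where
      open ≈-Reasoning
      reorder : ∀ k d B → k * d + B * 0ℤ + B ≡ k * d + B * + 1
      reorder = solve-∀

  module _ {u : C²} (u-cocycle : IsCocycle²-mod u) where

    private
      ε : ℤ
      ε = u e e

      U : C²
      U x y = u x y - ε

      U-cocycle : IsCocycle²-mod U
      U-cocycle x y z = ≈-trans (≡⇒≈ (shift (u y z) (u (dmul x y) z) (u x (dmul y z)) (u x y) ε)) (u-cocycle x y z)
        where
        shift : ∀ a b c d ε → a - ε - (b - ε) + (c - ε) - (d - ε) ≡ a - b + c - d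
        shift = solve-∀

      U-unitˡ : ∀ y → U e y ≈ 0ℤ
      U-unitˡ y = ≈-trans (unitˡ {U} U-cocycle y) (≡⇒≈ (ℤ.+-inverseʳ ε))

      U-unitʳ : ∀ x → U x e ≈ 0ℤ
      U-unitʳ x = ≈-trans (unitʳ {U} U-cocycle x) (≡⇒≈ (ℤ.+-inverseʳ ε))

      -- τ makes w = U + δ¹τ vanish on the pairs (r, rᵏ) with k + 1 < n and (rᵐ, s).
      S : ℕ → ℤ
      S zero    = 0ℤ
      S (suc i) = S i + U r (rot i)

      τ : Dih n → ℤ
      τ (i , false) = S (toℕ i)
      τ (i , true)  = S (toℕ i) + U (i , false) s

      τ-rot : ∀ {m} → m ℕ.< n → τ (rot m) ≡ S m
      τ-rot m<n = cong S (ℤ.+-injective (exponent-rot-< m<n))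

      w : C²
      w x y = U x y + δ¹ dmul τ x y

      w-cocycle : IsCocycle²-mod w
      w-cocycle x y z = ≈-trans (≡⇒≈ (trans (δ²-+ dmul U (δ¹ dmul τ) x y z)
                                            (cong (_+_ (δ² U x y z)) (δ²∘δ¹ dmul dmul-assoc τ x y z))))
                                (≈-trans (+-congʳ 0ℤ (U-cocycle x y z)) (≡⇒≈ refl))

      0<n : 0 ℕ.< n
      0<n = ℕ.<-trans 0<h h<n

      w-ee : w e e ≡ 0ℤ
      w-ee = begin
        U e e + (τ e - τ (dmul e e) + τ e)    ≡⟨ cong (λ x → U e e + (τ e - τ x + τ e)) (dmul-identityˡ e) ⟩
        U e e + (τ e - τ e + τ e)             ≡⟨ cong₂ (λ a t → a + (t - t + t)) (ℤ.+-inverseʳ ε) (τ-rot 0<n) ⟩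
        0ℤ                                    ∎
        where open ≡-Reasoning

      w-e-left : ∀ y → w e y ≈ 0ℤ
      w-e-left y = ≈-trans (unitˡ {w} w-cocycle y) (≡⇒≈ w-ee)

      w-e-right : ∀ x → w x e ≈ 0ℤ
      w-e-right x = ≈-trans (unitʳ {w} w-cocycle x) (≡⇒≈ w-ee)

      w-r-rot : ∀ m → suc m ℕ.< n → w r (rot m) ≈ 0ℤ
      w-r-rot m 1+m<n = begin
        U r (rot m) + (τ (rot m) - τ (dmul r (rot m)) + τ r)
          ≡⟨ cong (λ x → U r (rot m) + (τ (rot m) - τ x + τ r)) (rot·rot 1 m) ⟩
        U r (rot m) + (τ (rot m) - τ (rot (suc m)) + τ r)
          ≡⟨ cong₂ (λ a b → U r (rot m) + (a - b + τ r)) (τ-rot m<n) (τ-rot 1+m<n) ⟩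
        U r (rot m) + (S m - (S m + U r (rot m)) + τ r)
          ≡⟨ cancel (U r (rot m)) (S m) (τ r) ⟩
        τ r
          ≡⟨ τ-rot 1<n ⟩
        0ℤ + U r e
          ≈⟨ +-congˡ 0ℤ (U-unitʳ r) ⟩
        0ℤ                                                          ∎
        where
        open ≈-Reasoning
        m<n : m ℕ.< n
        m<n = ℕ.<-trans (ℕ.n<1+n m) 1+m<n
        1<n : 1 ℕ.< n
        1<n = ℕ.≤-<-trans (ℕ.s≤s ℕ.z≤n) 1+m<n
        cancel : ∀ a t b → a + (t - (t + a) + b) ≡ b
        cancel = solve-∀

      w-rot-s : ∀ m → w (rot m) s ≈ 0ℤ
      w-rot-s m = begin
        U (rot m) s + (τ s - τ (dmul (rot m) s) + τ (rot m))
          ≡⟨ cong (λ x → U (rot m) s + (τ s - τ x + τ (rot m))) (rot·s m) ⟩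
        U (rot m) s + (τ s - (τ (rot m) + U (rot m) s) + τ (rot m))
          ≡⟨ cancel (U (rot m) s) (τ s) (τ (rot m)) ⟩
        τ e + U e s
          ≡⟨ cong (_+ U e s) (τ-rot 0<n) ⟩
        0ℤ + U e s
          ≈⟨ +-congˡ 0ℤ (U-unitˡ s) ⟩
        0ℤ ∎
        where
        open ≈-Reasoning
        cancel : ∀ a b t → a + (b - (t + a) + t) ≡ b
        cancel = solve-∀

    open Normalised w w-cocycle w-e-left w-e-right w-r-rot w-rot-s

    private
      w-comm : ∀ {x y} → dmul x y ≡ dmul y x → w x y - w y x ≡ u x y - u y x
      w-comm {x} {y} xy≡yx = trans (cong (λ z → w x y - (U y x + (τ x - τ z + τ y))) (sym xy≡yx))
        (cancel (u x y) (u y x) ε (τ x) (τ y) (τ (dmul x y)))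
        where
        cancel : ∀ a b ε tx ty txy → a - ε + (ty - txy + tx) - (b - ε + (tx - txy + ty)) ≡ a - b
        cancel = solve-∀

      w-rot-h-ref : ∀ a → u (rot h) (ref a) ≈ u (ref a) (rot h) → w (rot h) (ref a) ≈ w (ref a) (rot h)
      w-rot-h-ref a u-comm = difference≈0 (≈-trans (≡⇒≈ (w-comm (rot-h-central (ref a))))
        (≈-trans (-‿cong u-comm (≡⇒≈ refl)) (≡⇒≈ (ℤ.+-inverseʳ (u (ref a) (rot h))))))

      A≈hk : ∀ (a : Fin n) → u (rot h) (ref (toℕ a)) ≈ u (ref (toℕ a)) (rot h) → A ≈ + h * k
      A≈hk a u-comm with toℕ a ℕ.<? h
      ... | yes a<h = ≈-trans (≡⇒≈ (sym (ℤ.+-identityˡ A))) (≈-trans (+-congʳ A (begin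
        0ℤ                                  ≈⟨ w-rot-rot-< h (toℕ a) h+a<n ⟨
        w (rot h) (rot (toℕ a))             ≈⟨ w-rot-ref h (toℕ a) ⟨
        w (rot h) (ref (toℕ a))             ≈⟨ w-rot-h-ref (toℕ a) u-comm ⟩
        w (ref (toℕ a)) (rot h)             ≈⟨ w-ref-rot-< (toℕ a) h a<h h<n ⟩
        G h                                 ≈⟨ G≈-pos h 0<h h<n ⟩
        + h * k - A                         ∎)) (≡⇒≈ (cancel (+ h * k) A)))
        where
        open ≈-Reasoning
        h+a<n : h ℕ.+ toℕ a ℕ.< n
        h+a<n = subst (h ℕ.+ toℕ a ℕ.<_) (sym n≡h+h) (ℕ.+-monoʳ-< h a<h)
        cancel : ∀ a A → a - A + A ≡ a
        cancel = solve-∀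
      ... | no a≮h = begin
        A                                   ≈⟨ w-rot-rot-≥ h (toℕ a) h<n (Fin.toℕ<n a) n≤h+a ⟨
        w (rot h) (rot (toℕ a))             ≈⟨ w-rot-ref h (toℕ a) ⟨
        w (rot h) (ref (toℕ a))             ≈⟨ w-rot-h-ref (toℕ a) u-comm ⟩
        w (ref (toℕ a)) (rot h)             ≈⟨ w-ref-rot-≥ (toℕ a) h 0<h (ℕ.≮⇒≥ a≮h) (Fin.toℕ<n a) ⟩
        G h + A                             ≈⟨ +-congʳ A (G≈-pos h 0<h h<n) ⟩
        + h * k - A + A                     ≡⟨ cancel (+ h * k) A ⟩
        + h * k                             ∎
        where
        open ≈-Reasoning
        n≤h+a : n ℕ.≤ h ℕ.+ toℕ a
        n≤h+a = subst (ℕ._≤ h ℕ.+ toℕ a) (sym n≡h+h) (ℕ.+-monoʳ-≤ h (ℕ.≮⇒≥ a≮h))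
        cancel : ∀ a A → a - A + A ≡ a
        cancel = solve-∀

    integralLift : ∀ (a : Fin n) → u (rot h) (a , true) ≈ u (a , true) (rot h) → IntegralLift dmul M u
    integralLift a u-comm = record
      { cocycle   = c
      ; isCocycle = c-cocycle
      ; γ         = γ
      ; lift      = lift
      }
      where
      c : C²
      c x y = k * Δ x y + B * reflectionCarry x y

      c-cocycle : ∀ x y z → δ² c x y z ≡ 0ℤ
      c-cocycle x y z = begin
        δ² c x y z
          ≡⟨ δ²-+ dmul (λ x y → k * Δ x y) (λ x y → B * reflectionCarry x y) x y z ⟩
        δ² (λ x y → k * Δ x y) x y z + δ² (λ x y → B * reflectionCarry x y) x y z
          ≡⟨ cong₂ _+_ (δ²-scale dmul Δ k x y z) (δ²-scale dmul reflectionCarry B x y z) ⟩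
        k * δ² Δ x y z + B * δ² reflectionCarry x y z
          ≡⟨ cong₂ (λ p q → k * p + B * q) (Δ-cocycle x y z) (reflectionCarry-cocycle x y z) ⟩
        k * 0ℤ + B * 0ℤ
          ≡⟨ zeros k B ⟩
        0ℤ ∎
        where
        open ≡-Reasoning
        zeros : ∀ k B → k * 0ℤ + B * 0ℤ ≡ 0ℤ
        zeros = solve-∀

      γ : Dih n → ℤ
      γ g = ε - τ g

      lift : ∀ x y → u x y ≈ c x y + δ¹ dmul γ x y
      lift x y = begin
        u x y                        ≡⟨ unfold (u x y) ε (τ x) (τ y) (τ (dmul x y)) ⟩
        w x y + δ¹ dmul γ x y        ≈⟨ +-congʳ (δ¹ dmul γ x y) (w-normal A≈hk′ x y) ⟩
        c x y + δ¹ dmul γ x y        ∎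
        where
        open ≈-Reasoning
        A≈hk′ : A ≈ + h * k
        A≈hk′ = A≈hk a (subst (λ t → u (rot h) t ≈ u t (rot h)) (ref-toℕ a) u-comm)
        unfold : ∀ a ε tx ty txy → a ≡ a - ε + (ty - txy + tx) + (ε - ty - (ε - txy) + (ε - tx))
        unfold = solve-∀

record KleinPair {n : ℕ} {{_ : NonZero n}} (x y : Dih n) : Set where
  field
    x²≡e  : dmul x x ≡ dunit
    y²≡e  : dmul y y ≡ dunit
    xy²≡e : dmul (dmul x y) (dmul x y) ≡ dunit
    x≢e   : x ≢ dunit
    y≢e   : y ≢ dunit
    xy≢e  : dmul x y ≢ dunit
    x≢y   : x ≢ y

module _ {m : ℕ} {{_ : NonZero m}} (q : ℕ) (m≡q+q : m ≡ q ℕ.+ q) where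

  open Rotations {m}
  open HalfTurn q m≡q+q

  halfTurn-reflection-kleinPair : KleinPair (rot q) (ref 0)
  halfTurn-reflection-kleinPair = record
    { x²≡e  = rot-h-involution
    ; y²≡e  = DihedralGroup.dinv-inverseʳ (ref 0)
    ; xy²≡e = DihedralGroup.dinv-inverseʳ (dmul (rot q) (ref 0))
    ; x≢e   = rot-h≢dunit
    ; y≢e   = λ ()
    ; xy≢e  = λ ()
    ; x≢y   = λ ()
    }

module _ {m n : ℕ} {{_ : NonZero m}} {{_ : NonZero n}} (ψ : Dih m → Dih n)
         (ψ-injective : Injective _≡_ _≡_ ψ) (ψ-hom : ∀ x y → ψ (dmul x y) ≡ dmul (ψ x) (ψ y)) where

  open DihedralGroupProperties {n} using (\\-leftDividesʳ)
  open DihedralGroup using (dinv-inverseˡ; dmul-identityˡ)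

  ψ-dunit : ψ dunit ≡ dunit
  ψ-dunit = begin
    ψ dunit                                ≡⟨ \\-leftDividesʳ (ψ dunit) (ψ dunit) ⟨
    dmul (dinv (ψ dunit)) (dmul (ψ dunit) (ψ dunit))  ≡⟨ cong (dmul (dinv (ψ dunit))) (sym (ψ-hom dunit dunit)) ⟩
    dmul (dinv (ψ dunit)) (ψ (dmul dunit dunit))      ≡⟨ cong (λ x → dmul (dinv (ψ dunit)) (ψ x)) (dmul-identityˡ dunit) ⟩
    dmul (dinv (ψ dunit)) (ψ dunit)        ≡⟨ dinv-inverseˡ (ψ dunit) ⟩
    dunit                                  ∎
    where open ≡-Reasoning

  kleinPair-image : ∀ {x y} → KleinPair x y → KleinPair (ψ x) (ψ y)
  kleinPair-image {x} {y} K = record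
    { x²≡e  = involution x²≡e
    ; y²≡e  = involution y²≡e
    ; xy²≡e = subst (λ z → dmul z z ≡ dunit) (ψ-hom x y) (involution xy²≡e)
    ; x≢e   = nontrivial x≢e
    ; y≢e   = nontrivial y≢e
    ; xy≢e  = nontrivial xy≢e ∘′ trans (ψ-hom x y)
    ; x≢y   = x≢y ∘′ ψ-injective
    }
    where
    open KleinPair K
    involution : ∀ {z} → dmul z z ≡ dunit → dmul (ψ z) (ψ z) ≡ dunit
    involution {z} z²≡e = trans (sym (ψ-hom z z)) (trans (cong ψ z²≡e) ψ-dunit)
    nontrivial : ∀ {z} → z ≢ dunit → ψ z ≢ dunit
    nontrivial z≢e ψz≡e = z≢e (ψ-injective (trans ψz≡e (sym ψ-dunit)))

module _ {n : ℕ} {{_ : NonZero n}} (H : Subgroup {n}) (h : ℕ) (n≡h+h : n ≡ h ℕ.+ h) where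

  open Subgroup H
  open HalfTurn h n≡h+h

  -- Of x, y and xy, at least one is a rotation and at least one a reflection;
  -- the only rotation of order two is the half turn.
  halfTurn-reflection-∈ : ∀ {x y} → T (mem x) → T (mem y) → KleinPair x y →
    T (mem (Rotations.rot h)) × ∃ λ (a : Fin n) → T (mem (a , true))
  halfTurn-reflection-∈ {c , false} {d , true}  x∈H y∈H K =
    subst (T ∘ mem) (involution-rotation c (KleinPair.x²≡e K) (KleinPair.x≢e K)) x∈H , d , y∈H
  halfTurn-reflection-∈ {c , true}  {d , false} x∈H y∈H K =
    subst (T ∘ mem) (involution-rotation d (KleinPair.y²≡e K) (KleinPair.y≢e K)) y∈H , c , x∈H
  halfTurn-reflection-∈ {c , true}  {d , true}  x∈H y∈H K =
    subst (T ∘ mem) (involution-rotation _ (KleinPair.xy²≡e K) (KleinPair.xy≢e K)) (mem-· x∈H y∈H) , c , x∈H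
  halfTurn-reflection-∈ {c , false} {d , false} x∈H y∈H K =
    contradiction (trans (involution-rotation c (KleinPair.x²≡e K) (KleinPair.x≢e K))
                         (sym (involution-rotation d (KleinPair.y²≡e K) (KleinPair.y≢e K)))) (KleinPair.x≢y K)

4∣m+m⇒even : ∀ {m} → 4 ∣ m ℕ.+ m → ∃ λ q → m ≡ q ℕ.+ q
4∣m+m⇒even {m} (divides q m+m≡4q) = q , ℕ.*-cancelˡ-≡ m (q ℕ.+ q) 2 (trans (double m) (trans m+m≡4q (quadruple q)))
  where
  double : ∀ m → 2 ℕ.* m ≡ m ℕ.+ m
  double = ℕ-Ring.solve-∀
  quadruple : ∀ q → q ℕ.* 4 ≡ 2 ℕ.* (q ℕ.+ q)
  quadruple = ℕ-Ring.solve-∀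

dihedralSize-nonZero : ∀ {n} {{_ : NonZero n}} → ℤ.NonZero (LeftInvariantSum.size (dihedralSum {n}))
dihedralSize-nonZero {n} = ℕ.≢-nonZero (λ n+n≡0 → ℕ.≢-nonZero⁻¹ n (ℕ.m+n≡0⇒m≡0 n n+n≡0))

module _ {n m : ℕ} {{_ : NonZero n}} {{_ : NonZero m}} (H : Subgroup {n})
         (φ : Dih m → Carrier H) (φ-bijective : Bijective _≡_ _≡_ φ)
         (φ-hom : ∀ x y → φ (dmul x y) ≡ hmul H (φ x) (φ y))
         (|H|≡n : HasIndex2 H) (4∣|H| : 4 ∣ order H) where

  open LeftInvariantSum (dihedralSum {n}) using (∑; size)

  n≡m+m : n ≡ m ℕ.+ m
  n≡m+m = trans (sym |H|≡n) (order-bijection H φ φ-bijective)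

  private
    m-even : ∃ λ q → m ≡ q ℕ.+ q
    m-even = 4∣m+m⇒even (subst (4 ∣_) (order-bijection H φ φ-bijective) 4∣|H|)

    ψ : Dih m → Dih n
    ψ x = proj₁ (φ x)

    halfTurn-reflection-in-H : T (Subgroup.mem H (Rotations.rot m)) × ∃ λ a → T (Subgroup.mem H (a , true))
    halfTurn-reflection-in-H = halfTurn-reflection-∈ H m n≡m+m (proj₂ (φ _)) (proj₂ (φ _))
      (kleinPair-image ψ (λ eq → proj₁ φ-bijective (subset-≡ eq)) (λ x y → cong proj₁ (φ-hom x y))
        (halfTurn-reflection-kleinPair (proj₁ m-even) (proj₂ m-even)))

  restriction-injective : ResInjective³ H
  restriction-injective f f-cocycle (φH , f|H≡δφH) =
    coboundary-from-lift dihedralSum {{dihedralSize-nonZero}} DihedralGroup.dmul-assoc f f-cocycle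
      (NormalForm.integralLift m n≡m+m size (Averaging.averaging³-mod dihedralSum f f-cocycle) a κ)
    where
    open HalfTurn m n≡m+m using (rot-h-involution; rot-h-central)
    a : Fin n
    a = proj₁ (proj₂ halfTurn-reflection-in-H)
    κ : Congruence._≈_ size (∑ (f (Rotations.rot m) (a , true))) (∑ (f (a , true) (Rotations.rot m)))
    κ = CommutingInvolutions.averaged-comm H (proj₁ halfTurn-reflection-in-H) (proj₂ (proj₂ halfTurn-reflection-in-H))
          rot-h-involution (DihedralGroup.dinv-inverseʳ (a , true)) (rot-h-central (a , true))
          f-cocycle φH f|H≡δφH

lemma2p2 : (n : ℕ) → {{_ : NonZero n}} → 2 ∣ n →
    (H : Subgroup {n}) →
    IsDihedral H → HasIndex2 H → 4 ∣ order H →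
    ResInjective³ H
lemma2p2 n _ H (m , m≢0 , φ , φ-bijective , φ-hom) =
  restriction-injective {{_}} {{m≢0}} H φ φ-bijective φ-hom
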